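{- Let $H=(h_{ij})$ be any $n\times n$ matrix with entries in $\{+1,-1\}$, let $G$ be its $n$-full oriented hypergraph, and let $\mathbf{L}_G=HH^{T}$. Then the sum $\sum_{c}(-1)^{pc(c)}$ over all contributors $c$ of $G$ lying in non-edge-monic tail-equivalence classes equals $0$, and \[ \det(\mathbf{L}_G)=\sum_{\mathcal{A}\in\mathfrak{A}_1}\ \sum_{c\in\mathcal{A}}(-1)^{pc(c)} . \]
   Context: Let $H=(h_{ij})$ be an $n\times n$ $\{\pm1\}$-matrix. Its $n$-full oriented hypergraph $G$ has vertices $v_1,\dots,v_n$, edges $e_1,\dots,e_n$, and exactly one incidence $(v_i,e_j)$ for every pair $i,j$, with orientation $\sigma(v_i,e_j)=h_{ij}$ ($H$ is the incidence matrix of $G$). A step is a triple $(v,e,w)$ of a tail vertex $v$, an edge $e$, and a head vertex $w$ (it uses tail incidence $(v,e)$ and head incidence $(w,e)$); it is a backstep if $w=v$. The sign of the step is $-\sigma(v,e)\sigma(w,e)$ (so every backstep has sign $-1$). A contributor $c$ of $G$ consists of one step $(v,f(v),\pi(v))$ for each vertex $v$, where $f:V\to E$ is an arbitrary function and $\pi:V\to V$ is a bijection; contributors correspond bijectively to pairs $(f,\pi)$. The components of $c$ are the cycles of $\pi$ (a fixed point gives a component consisting of one backstep); the sign of a component is the product of the signs of its steps, and $pc(c)$ is the number of components of $c$ of sign $+1$. Two contributors are tail-equivalent if they have the same set of tail incidences, i.e. the same $f$. A tail-equivalence class is edge-monic if $f$ is injective (so each edge contains exactly one tail incidence) and non-edge-monic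 otherwise. $\mathfrak{A}_1$ denotes the set of edge-monic tail-equivalence classes. -}

module Defs where

open import Data.Bool using (Bool; true; false; if_then_else_; _∧_; not)
open import Data.Nat using (ℕ; zero; suc; _<ᵇ_; _≤ᵇ_)
open import Data.Fin using (Fin; toℕ; _≟_)
open import Data.Fin.Properties using (all?)
open import Data.List using (List; []; _∷_; map; concatMap; filter; foldr; length; upTo; allFin)
open import Data.Bool.ListAction using (all; any)
open import Data.Integer using (ℤ; _+_; _*_; -_; 0ℤ; 1ℤ; -1ℤ)
open import Data.Sign as Sign using (Sign)
open import Relation.Nullary.Decidable using (⌊_⌋)
open import Relation.Binary.PropositionalEquality using (_≡_)
open import Data.Vec.Functional using () renaming (_∷_ to _∷ᶠ_)

sumℤ : List ℤ → ℤ
sumℤ = foldr _+_ 0ℤ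

prodℤ : List ℤ → ℤ
prodℤ = foldr _*_ 1ℤ

prodSign : List Sign → Sign
prodSign = foldr Sign._*_ Sign.+

_==_ : {n : ℕ} → Fin n → Fin n → Bool
i == j = ⌊ i ≟ j ⌋

neg1^ : ℕ → ℤ
neg1^ zero = 1ℤ
neg1^ (suc k) = - neg1^ k

signToℤ : Sign → ℤ
signToℤ Sign.+ = 1ℤ
signToℤ Sign.- = -1ℤ

allFuns : (m n : ℕ) → List (Fin m → Fin n)
allFuns zero    n = (λ ()) ∷ []
allFuns (suc m) n = concatMap (λ g → map (λ x → x ∷ᶠ g) (allFin n)) (allFuns m n)

isInjective : {m n : ℕ} → (Fin m → Fin n) → Bool
isInjective {m} f =
  all (λ i → all (λ j → if f i == f j then i == j else true) (allFin m)) (allFin m)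

-- All bijections Fin n → Fin n (for endomaps of a finite set, injective = bijective)
allPerms : (n : ℕ) → List (Fin n → Fin n)
allPerms n = filter (λ π → isInjective π Data.Bool.≟ true) (allFuns n n)
  where import Data.Bool

inversions : {n : ℕ} → (Fin n → Fin n) → ℕ
inversions {n} π =
  length (filter (λ b → b Data.Bool.≟ true)
    (concatMap (λ i → map (λ j → (toℕ i <ᵇ toℕ j) ∧ (toℕ (π j) <ᵇ toℕ (π i))) (allFin n)) (allFin n)))
  where import Data.Bool

det : {n : ℕ} → (Fin n → Fin n → ℤ) → ℤ
det {n} M = sumℤ (map (λ π → neg1^ (inversions π) * prodℤ (map (λ i → M i (π i)) (allFin n))) (allPerms n))

-- The n-full oriented hypergraph of a {±1}-matrix H : vertices Fin n,
-- edges Fin n, σ(v_i , e_j) = H i j.  Laplacian L = H Hᵀ.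

Matrix± : ℕ → Set
Matrix± n = Fin n → Fin n → Sign

laplacian : {n : ℕ} → Matrix± n → Fin n → Fin n → ℤ
laplacian {n} H i j = sumℤ (map (λ k → signToℤ (H i k) * signToℤ (H j k)) (allFin n))

-- A contributor is a pair (f , π), f : V → E arbitrary, π : V → V a bijection,
-- consisting of the steps (v , f v , π v).
-- sign of the step (v, f v, π v) : - σ(v, f v) σ(π v, f v)
stepSign : {n : ℕ} → Matrix± n → (f π : Fin n → Fin n) → Fin n → Sign
stepSign H f π v = Sign.opposite (H v (f v) Sign.* H (π v) (f v))

iter : {n : ℕ} → (Fin n → Fin n) → ℕ → Fin n → Fin n
iter π zero    v = v
iter π (suc k) v = π (iter π k v)

inCycle : {n : ℕ} → (Fin n → Fin n) → Fin n → Fin n → Bool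
inCycle {n} π v w = any (λ k → iter π k v == w) (upTo n)

cycleOf : {n : ℕ} → (Fin n → Fin n) → Fin n → List (Fin n)
cycleOf {n} π v = filter (λ w → inCycle π v w Data.Bool.≟ true) (allFin n)
  where import Data.Bool

componentSign : {n : ℕ} → Matrix± n → (f π : Fin n → Fin n) → Fin n → Sign
componentSign H f π v = prodSign (map (stepSign H f π) (cycleOf π v))

isRep : {n : ℕ} → (Fin n → Fin n) → Fin n → Bool
isRep π v = all (λ w → toℕ v ≤ᵇ toℕ w) (cycleOf π v)

isPositive : Sign → Bool
isPositive Sign.+ = true
isPositive Sign.- = false

-- pc(c) : number of components of sign +1 (each cycle counted once via its representative)
pc : {n : ℕ} → Matrix± n → (f π : Fin n → Fin n) → ℕ
pc {n} H f π =
  length (filter (λ v → (isRep π v ∧ isPositive (componentSign H f π v)) Data.Bool.≟ true) (allFin n))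
  where import Data.Bool

-- Σ_{c ∈ class of f} (-1)^{pc(c)} : sum over the tail-equivalence class with tail map f
classSum : {n : ℕ} → Matrix± n → (Fin n → Fin n) → ℤ
classSum {n} H f = sumℤ (map (λ π → neg1^ (pc H f π)) (allPerms n))

-- the tail-equivalence classes, indexed by f : V → E
edgeMonicClasses : (n : ℕ) → List (Fin n → Fin n)
edgeMonicClasses n = filter (λ f → isInjective f Data.Bool.≟ true) (allFuns n n)
  where import Data.Bool

nonEdgeMonicClasses : (n : ℕ) → List (Fin n → Fin n)
nonEdgeMonicClasses n = filter (λ f → isInjective f Data.Bool.≟ false) (allFuns n n)
  where import Data.Bool

-- Expanding the Leibniz formula for det (H Hᵀ) and distributing the products of row sums gives
-- Σ_f Σ_π sgn π ∏_v h(v, f v) h(π v, f v), a sum over all contributors (f , π). Each step sign is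
-- minus the corresponding factor, so this product equals ∏_C (-1)^|C| sign(C) over the cycles C of π;
-- together with sgn π = ∏_C (-1)^(|C| - 1) the term becomes ∏_C (- sign(C)) = (-1)^pc.
-- If f is not injective, say f i = f j with i ≠ j, then π ↦ π ∘ (i j) keeps the orientation product
-- and flips sgn π, so the contributors of a non-edge-monic class cancel in pairs.

module Submission where

open import Defs
open import Data.Nat using (ℕ)
open import Data.List using (map)
open import Data.Integer using (0ℤ)
open import Data.Product using (_×_)
open import Relation.Binary.PropositionalEquality using (_≡_)

open import Algebra.Bundles using (CommutativeSemigroup)
open import Algebra.Core using (Op₂)
open import Algebra.Structures using (IsCommutativeMonoid)
open import Data.Bool using (Bool; true; false; if_then_else_; _∧_; not)
import Data.Bool as Bool
import Data.Bool.Properties as Boolₚ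
open import Data.Bool.ListAction using (all; any)
open import Data.Fin using (Fin; toℕ) renaming (zero to fzero; suc to fsuc)
open import Data.Fin.Properties using (toℕ-injective; toℕ<n; _≟_; pigeonhole; any?)
open import Data.Fin.Permutation.Components using (transpose; transpose-inverse)
open import Data.Integer using (ℤ; _+_; _*_; -_; +0; +[1+_]; -[1+_])
import Data.Integer.Properties as ℤ
open import Data.List using (List; []; _∷_; _++_; foldr; concat; concatMap; filter; allFin; length; upTo)
import Data.List.Properties as List
open import Data.List.Extrema.Nat using (argmin; argmin-all; f[argmin]≤f[xs])
open import Data.List.Membership.Propositional using (_∈_)
open import Data.List.Membership.Propositional.Properties
  using (∈-map⁺; ∈-map⁻; ∈-allFin; ∈-upTo⁺; ∈-filter⁺; ∈-filter⁻; ∈-concatMap⁺)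
open import Data.List.Membership.Propositional.Properties.WithK using (unique∧set⇒bag)
open import Data.List.Relation.Binary.BagAndSetEquality using (∼bag⇒↭)
open import Data.List.Relation.Binary.Disjoint.Propositional using (Disjoint)
open import Data.List.Relation.Binary.Permutation.Propositional using (_↭_; ↭⇒↭ₛ)
import Data.List.Relation.Binary.Permutation.Propositional.Properties as Permutationₚ
open import Data.List.Relation.Binary.Permutation.Setoid.Properties using (foldr-commMonoid)
open import Data.List.Relation.Unary.All using ([]; _∷_)
import Data.List.Relation.Unary.All as All
import Data.List.Relation.Unary.All.Properties as Allₚ
open import Data.List.Relation.Unary.AllPairs using ([]; _∷_)
import Data.List.Relation.Unary.AllPairs as AllPairs
import Data.List.Relation.Unary.AllPairs.Properties as AllPairsₚ
open import Data.List.Relation.Unary.Any using (here; there)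
import Data.List.Relation.Unary.Any as Any
open import Data.List.Relation.Unary.Unique.Propositional using (Unique)
import Data.List.Relation.Unary.Unique.Propositional.Properties as Uniqueₚ
import Data.Nat as ℕ
open import Data.Nat using (zero; suc; _<_; _≤_; _<ᵇ_; _≤ᵇ_; _∸_)
open import Data.Nat.DivMod using (_%_; _/_; m%n<n; m≡m%n+[m/n]*n)
import Data.Nat.Properties as ℕₚ
open import Data.Product using (_,_; ∃-syntax; proj₁; proj₂)
open import Data.Sign using (Sign) renaming (_*_ to _·_)
import Data.Sign.Properties as Sign
open import Data.Vec using (Vec; []; _∷_)
import Data.Vec as Vec
import Data.Vec.Properties as Vecₚ
open import Data.Vec.Functional using () renaming (_∷_ to _∷ᶠ_)
open import Function using (_∘_; id; Injective; mk⇔; Equivalence)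
open import Level using (0ℓ)
open import Relation.Binary using (tri<; tri≈; tri>)
open import Relation.Binary.PropositionalEquality
  using (_≢_; _≗_; refl; sym; trans; cong; cong₂; subst; subst₂; setoid; module ≡-Reasoning)
open import Relation.Nullary using (¬_; ¬?; Dec; does; yes; no; contradiction)
open import Relation.Nullary.Decidable using (dec-true; dec-false; decidable-stable)
open import Relation.Unary using (Pred; Decidable)

module CommutativeFold {A : Set} {_∙_ : Op₂ A} {ε : A}
  (isCM : IsCommutativeMonoid _≡_ _∙_ ε) where

  open IsCommutativeMonoid isCM using (assoc; identityˡ; identityʳ; isCommutativeSemigroup)

  private
    commutativeSemigroup : CommutativeSemigroup 0ℓ 0ℓ
    commutativeSemigroup = record { isCommutativeSemigroup = isCommutativeSemigroup }

  open import Algebra.Properties.CommutativeSemigroup commutativeSemigroup using (interchange; x∙yz≈y∙xz)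

  fold : List A → A
  fold = foldr _∙_ ε

  fold-++ : ∀ xs ys → fold (xs ++ ys) ≡ fold xs ∙ fold ys
  fold-++ []       ys = sym (identityˡ _)
  fold-++ (x ∷ xs) ys = trans (cong (x ∙_) (fold-++ xs ys)) (sym (assoc _ _ _))

  fold-↭ : ∀ {xs ys} → xs ↭ ys → fold xs ≡ fold ys
  fold-↭ p = foldr-commMonoid (setoid A) isCM (↭⇒↭ₛ p)

  module _ {B : Set} where

    fold-map-cong : ∀ {f g : B → A} xs → (∀ x → x ∈ xs → f x ≡ g x) → fold (map f xs) ≡ fold (map g xs)
    fold-map-cong []       f≡g = refl
    fold-map-cong (x ∷ xs) f≡g = cong₂ _∙_ (f≡g x (here refl)) (fold-map-cong xs (λ y y∈xs → f≡g y (there y∈xs)))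

    fold-map-ext : ∀ {f g : B → A} xs → (∀ x → f x ≡ g x) → fold (map f xs) ≡ fold (map g xs)
    fold-map-ext xs f≡g = fold-map-cong xs (λ x _ → f≡g x)

    fold-map-ε : ∀ (xs : List B) → fold (map (λ _ → ε) xs) ≡ ε
    fold-map-ε []       = refl
    fold-map-ε (x ∷ xs) = trans (cong (ε ∙_) (fold-map-ε xs)) (identityˡ ε)

    fold-map-∙ : ∀ (f g : B → A) xs → fold (map (λ x → f x ∙ g x) xs) ≡ fold (map f xs) ∙ fold (map g xs)
    fold-map-∙ f g []       = sym (identityˡ ε)
    fold-map-∙ f g (x ∷ xs) = trans (cong ((f x ∙ g x) ∙_) (fold-map-∙ f g xs)) (interchange _ _ _ _)

    fold-concatMap : ∀ {C : Set} (h : C → List B) (f : B → A) xs →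
      fold (map f (concatMap h xs)) ≡ fold (map (λ c → fold (map f (h c))) xs)
    fold-concatMap h f []       = refl
    fold-concatMap h f (c ∷ xs) = begin
      fold (map f (h c ++ concatMap h xs))              ≡⟨ cong fold (List.map-++ f (h c) (concatMap h xs)) ⟩
      fold (map f (h c) ++ map f (concatMap h xs))      ≡⟨ fold-++ (map f (h c)) _ ⟩
      fold (map f (h c)) ∙ fold (map f (concatMap h xs)) ≡⟨ cong (_ ∙_) (fold-concatMap h f xs) ⟩
      fold (map f (h c)) ∙ fold (map (λ c → fold (map f (h c))) xs) ∎
      where open ≡-Reasoning

    fold-filter : ∀ {P : Pred B 0ℓ} (P? : Decidable P) (f : B → A) xs →
      fold (map f (filter P? xs)) ≡ fold (map (λ x → if does (P? x) then f x else ε) xs)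
    fold-filter P? f []       = refl
    fold-filter P? f (x ∷ xs) with does (P? x)
    ... | true  = cong (f x ∙_) (fold-filter P? f xs)
    ... | false = trans (fold-filter P? f xs) (sym (identityˡ _))

    fold-map-unique : ∀ (f : B → A) {xs} x₀ → Unique xs → x₀ ∈ xs →
      (∀ x → x ∈ xs → x ≢ x₀ → f x ≡ ε) → fold (map f xs) ≡ f x₀
    fold-map-unique f {x ∷ xs} x₀ (x∉xs ∷ _) (here refl) f≡ε = begin
      f x ∙ fold (map f xs)          ≡⟨ cong (f x ∙_) (fold-map-cong xs f≡ε-on-xs) ⟩
      f x ∙ fold (map (λ _ → ε) xs)  ≡⟨ cong (f x ∙_) (fold-map-ε xs) ⟩
      f x ∙ ε                        ≡⟨ identityʳ (f x) ⟩
      f x ∎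
      where
        open ≡-Reasoning
        f≡ε-on-xs : ∀ y → y ∈ xs → f y ≡ ε
        f≡ε-on-xs y y∈xs = f≡ε y (there y∈xs) (λ { refl → All.lookup x∉xs y∈xs refl })
    fold-map-unique f {x ∷ xs} x₀ (x∉xs ∷ u) (there x₀∈xs) f≡ε =
      trans (cong₂ _∙_ (f≡ε x (here refl) (λ { refl → All.lookup x∉xs x₀∈xs refl }))
                       (fold-map-unique f x₀ u x₀∈xs (λ y y∈xs → f≡ε y (there y∈xs))))
            (identityˡ _)

    fold-partition : ∀ (p : B → Bool) (f : B → A) xs →
      fold (map f (filter (λ x → p x Bool.≟ true) xs)) ∙ fold (map f (filter (λ x → p x Bool.≟ false) xs))
        ≡ fold (map f xs)
    fold-partition p f []       = identityˡ ε
    fold-partition p f (x ∷ xs) with p x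
    ... | true  = trans (assoc _ _ _) (cong (f x ∙_) (fold-partition p f xs))
    ... | false = trans (x∙yz≈y∙xz _ _ _) (cong (f x ∙_) (fold-partition p f xs))

  fold-map-comm : ∀ {B C : Set} (f : B → C → A) xs ys →
    fold (map (λ x → fold (map (f x) ys)) xs) ≡ fold (map (λ y → fold (map (λ x → f x y) xs)) ys)
  fold-map-comm f []       ys = sym (fold-map-ε ys)
  fold-map-comm f (x ∷ xs) ys =
    trans (cong (_ ∙_) (fold-map-comm f xs ys)) (sym (fold-map-∙ (f x) (λ y → fold (map (λ x → f x y) xs)) ys))

  fold-map-bijection : ∀ {B : Set} (f : B → A) (ψ ψ⁻¹ : B → B) →
    (∀ b → ψ (ψ⁻¹ b) ≡ b) → (∀ b → ψ⁻¹ (ψ b) ≡ b) →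
    ∀ {xs} → Unique xs → (∀ b → b ∈ xs) → fold (map (f ∘ ψ) xs) ≡ fold (map f xs)
  fold-map-bijection f ψ ψ⁻¹ ψψ⁻¹ ψ⁻¹ψ {xs} unique complete = begin
    fold (map (f ∘ ψ) xs)   ≡⟨ cong fold (List.map-∘ xs) ⟩
    fold (map f (map ψ xs)) ≡⟨ fold-↭ (Permutationₚ.map⁺ f map-ψ↭) ⟩
    fold (map f xs) ∎
    where
      open ≡-Reasoning
      ψ-injective : Injective _≡_ _≡_ ψ
      ψ-injective {x} {y} ψx≡ψy = trans (sym (ψ⁻¹ψ x)) (trans (cong ψ⁻¹ ψx≡ψy) (ψ⁻¹ψ y))
      map-ψ↭ : map ψ xs ↭ xs
      map-ψ↭ = ∼bag⇒↭ (unique∧set⇒bag (Uniqueₚ.map⁺ ψ-injective unique) unique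
        (mk⇔ (λ _ → complete _) (λ _ → subst (_∈ map ψ xs) (ψψ⁻¹ _) (∈-map⁺ ψ (complete _)))))

bool-ext : ∀ {b c} → (b ≡ true → c ≡ true) → (c ≡ true → b ≡ true) → b ≡ c
bool-ext {true}  {true}  _ _ = refl
bool-ext {true}  {false} b⇒c _ = sym (b⇒c refl)
bool-ext {false} {true}  _ c⇒b = c⇒b refl
bool-ext {false} {false} _ _ = refl

does-≟-true : ∀ b → does (b Bool.≟ true) ≡ b
does-≟-true true  = refl
does-≟-true false = refl

module _ {B : Set} (p : B → Bool) where

  all≡true⇒∀ : ∀ xs → all p xs ≡ true → ∀ {x} → x ∈ xs → p x ≡ true
  all≡true⇒∀ (y ∷ xs) all≡true (here refl) with p y
  ... | true = refl
  all≡true⇒∀ (y ∷ xs) all≡true (there x∈xs) with p y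
  ... | true = all≡true⇒∀ xs all≡true x∈xs

  ∀⇒all≡true : ∀ xs → (∀ {x} → x ∈ xs → p x ≡ true) → all p xs ≡ true
  ∀⇒all≡true []       _   = refl
  ∀⇒all≡true (y ∷ xs) p≡true rewrite p≡true (here refl) = ∀⇒all≡true xs (p≡true ∘ there)

  all≡false⇒∃ : ∀ xs → all p xs ≡ false → ∃[ x ] x ∈ xs × p x ≡ false
  all≡false⇒∃ (y ∷ xs) all≡false with p y in py
  ... | false = y , here refl , py
  ... | true with all≡false⇒∃ xs all≡false
  ...   | x , x∈xs , px = x , there x∈xs , px

  any≡true⇒∃ : ∀ xs → any p xs ≡ true → ∃[ x ] x ∈ xs × p x ≡ true
  any≡true⇒∃ (y ∷ xs) any≡true with p y in py
  ... | true = y , here refl , py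
  ... | false with any≡true⇒∃ xs any≡true
  ...   | x , x∈xs , px = x , there x∈xs , px

  ∃⇒any≡true : ∀ xs {x} → x ∈ xs → p x ≡ true → any p xs ≡ true
  ∃⇒any≡true (y ∷ xs) (here refl) px rewrite px = refl
  ∃⇒any≡true (y ∷ xs) (there x∈xs) px with p y
  ... | true  = refl
  ... | false = ∃⇒any≡true xs x∈xs px

==⇒≡ : ∀ {n} {x y : Fin n} → (x == y) ≡ true → x ≡ y
==⇒≡ {x = x} {y} x==y with x ≟ y
... | yes x≡y = x≡y

≡⇒== : ∀ {n} {x y : Fin n} → x ≡ y → (x == y) ≡ true
≡⇒== {x = x} refl with x ≟ x
... | yes _   = refl
... | no x≢x = contradiction refl x≢x

-- Expanding det (H Hᵀ)

module Sumℤ = CommutativeFold ℤ.+-0-isCommutativeMonoid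
module Prodℤ = CommutativeFold ℤ.*-1-isCommutativeMonoid
module ProdSign = CommutativeFold Sign.*-isCommutativeMonoid

map-allFin-suc : ∀ {B : Set} {m} (h : Fin (suc m) → B) → map h (allFin (suc m)) ≡ h fzero ∷ map (h ∘ fsuc) (allFin m)
map-allFin-suc h = trans (List.map-tabulate id h) (cong (h fzero ∷_) (sym (List.map-tabulate id (h ∘ fsuc))))

*-distribˡ-sum : ∀ {B : Set} x (f : B → ℤ) xs → x * sumℤ (map f xs) ≡ sumℤ (map (λ y → x * f y) xs)
*-distribˡ-sum x f []       = ℤ.*-zeroʳ x
*-distribˡ-sum x f (y ∷ xs) = trans (ℤ.*-distribˡ-+ x (f y) _) (cong (x * f y +_) (*-distribˡ-sum x f xs))

*-distribʳ-sum : ∀ {B : Set} x (f : B → ℤ) xs → sumℤ (map f xs) * x ≡ sumℤ (map (λ y → f y * x) xs)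
*-distribʳ-sum x f xs = trans (ℤ.*-comm _ x) (trans (*-distribˡ-sum x f xs) (Sumℤ.fold-map-ext xs (λ y → ℤ.*-comm x (f y))))

product-of-sums : ∀ m n (G : Fin m → Fin n → ℤ) →
  prodℤ (map (λ i → sumℤ (map (G i) (allFin n))) (allFin m))
    ≡ sumℤ (map (λ F → prodℤ (map (λ i → G i (F i)) (allFin m))) (allFuns m n))
product-of-sums zero    n G = refl
product-of-sums (suc m) n G = begin
  prodℤ (map (λ i → sumℤ (map (G i) (allFin n))) (allFin (suc m)))
    ≡⟨ cong prodℤ (map-allFin-suc (λ i → sumℤ (map (G i) (allFin n)))) ⟩
  sumℤ (map (G fzero) (allFin n)) * prodℤ (map (λ i → sumℤ (map (G (fsuc i)) (allFin n))) (allFin m))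
    ≡⟨ cong (sumℤ (map (G fzero) (allFin n)) *_) (product-of-sums m n (G ∘ fsuc)) ⟩
  sumℤ (map (G fzero) (allFin n)) * sumℤ (map P (allFuns m n))
    ≡⟨ *-distribˡ-sum (sumℤ (map (G fzero) (allFin n))) P (allFuns m n) ⟩
  sumℤ (map (λ g → sumℤ (map (G fzero) (allFin n)) * P g) (allFuns m n))
    ≡⟨ Sumℤ.fold-map-ext (allFuns m n) (λ g → *-distribʳ-sum (P g) (G fzero) (allFin n)) ⟩
  sumℤ (map (λ g → sumℤ (map (λ x → G fzero x * P g) (allFin n))) (allFuns m n))
    ≡⟨ Sumℤ.fold-map-ext (allFuns m n) (λ g → Sumℤ.fold-map-ext (allFin n) (λ x → sym (Q-cons x g))) ⟩
  sumℤ (map (λ g → sumℤ (map (λ x → Q (x ∷ᶠ g)) (allFin n))) (allFuns m n))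
    ≡⟨ Sumℤ.fold-map-ext (allFuns m n) (λ g → cong sumℤ (List.map-∘ (allFin n))) ⟩
  sumℤ (map (λ g → sumℤ (map Q (map (_∷ᶠ g) (allFin n)))) (allFuns m n))
    ≡⟨ Sumℤ.fold-concatMap (λ g → map (_∷ᶠ g) (allFin n)) Q (allFuns m n) ⟨
  sumℤ (map Q (allFuns (suc m) n)) ∎
  where
    open ≡-Reasoning
    P : (Fin m → Fin n) → ℤ
    P g = prodℤ (map (λ i → G (fsuc i) (g i)) (allFin m))
    Q : (Fin (suc m) → Fin n) → ℤ
    Q F = prodℤ (map (λ i → G i (F i)) (allFin (suc m)))
    Q-cons : ∀ x g → Q (x ∷ᶠ g) ≡ G fzero x * P g
    Q-cons x g = cong prodℤ (map-allFin-suc (λ i → G i ((x ∷ᶠ g) i)))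

expansionTerm : ∀ {n} → Matrix± n → (f π : Fin n → Fin n) → ℤ
expansionTerm {n} H f π =
  neg1^ (inversions π) * prodℤ (map (λ i → signToℤ (H i (f i)) * signToℤ (H (π i) (f i))) (allFin n))

det-laplacian-expansion : ∀ {n} (H : Matrix± n) →
  det (laplacian H) ≡ sumℤ (map (λ f → sumℤ (map (expansionTerm H f) (allPerms n))) (allFuns n n))
det-laplacian-expansion {n} H = begin
  det (laplacian H)
    ≡⟨ Sumℤ.fold-map-ext (allPerms n) (λ π → cong (neg1^ (inversions π) *_) (product-of-sums n n (entry π))) ⟩
  sumℤ (map (λ π → neg1^ (inversions π) * sumℤ (map (λ f → prodℤ (map (λ i → entry π i (f i)) (allFin n)))
                                                    (allFuns n n)))
            (allPerms n))
    ≡⟨ Sumℤ.fold-map-ext (allPerms n) (λ π → *-distribˡ-sum (neg1^ (inversions π)) _ (allFuns n n)) ⟩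
  sumℤ (map (λ π → sumℤ (map (λ f → expansionTerm H f π) (allFuns n n))) (allPerms n))
    ≡⟨ Sumℤ.fold-map-comm (λ π f → expansionTerm H f π) (allPerms n) (allFuns n n) ⟩
  sumℤ (map (λ f → sumℤ (map (expansionTerm H f) (allPerms n))) (allFuns n n)) ∎
  where
    open ≡-Reasoning
    entry : (Fin n → Fin n) → Fin n → Fin n → ℤ
    entry π i k = signToℤ (H i k) * signToℤ (H (π i) k)

-- The sign of a permutation

neg1^ᵇ : Bool → Sign
neg1^ᵇ true  = Sign.-
neg1^ᵇ false = Sign.+

signToℤ-· : ∀ s t → signToℤ (s · t) ≡ signToℤ s * signToℤ t
signToℤ-· Sign.- Sign.- = refl
signToℤ-· Sign.- Sign.+ = refl
signToℤ-· Sign.+ Sign.- = refl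
signToℤ-· Sign.+ Sign.+ = refl

signToℤ-opposite : ∀ s → signToℤ (Sign.- · s) ≡ - signToℤ s
signToℤ-opposite Sign.- = refl
signToℤ-opposite Sign.+ = refl

prodℤ-signToℤ : ∀ {B : Set} (g : B → Sign) xs → prodℤ (map (signToℤ ∘ g) xs) ≡ signToℤ (prodSign (map g xs))
prodℤ-signToℤ g []       = refl
prodℤ-signToℤ g (x ∷ xs) = trans (cong (signToℤ (g x) *_) (prodℤ-signToℤ g xs)) (sym (signToℤ-· (g x) _))

count : ∀ {B : Set} → (B → Bool) → List B → ℕ
count p xs = length (filter (λ x → p x Bool.≟ true) xs)

neg1^-count : ∀ {B : Set} (p : B → Bool) xs →
  neg1^ (count p xs) ≡ signToℤ (prodSign (map (neg1^ᵇ ∘ p) xs))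
neg1^-count p []       = refl
neg1^-count p (x ∷ xs) with p x
... | true  = trans (cong -_ (neg1^-count p xs)) (sym (signToℤ-opposite (prodSign (map (neg1^ᵇ ∘ p) xs))))
... | false = neg1^-count p xs

data Comparisonᵇ (x y : ℕ) : Set where
  less    : x < y → (x <ᵇ y) ≡ true  → (y <ᵇ x) ≡ false → Comparisonᵇ x y
  equal   : x ≡ y → Comparisonᵇ x y
  greater : y < x → (x <ᵇ y) ≡ false → (y <ᵇ x) ≡ true  → Comparisonᵇ x y

<⇒<ᵇ≡true : ∀ {m n} → m < n → (m <ᵇ n) ≡ true
<⇒<ᵇ≡true m<n = Equivalence.to Boolₚ.T-≡ (ℕₚ.<⇒<ᵇ m<n)

≥⇒<ᵇ≡false : ∀ {m n} → n ≤ m → (m <ᵇ n) ≡ false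
≥⇒<ᵇ≡false {m} {n} n≤m with m <ᵇ n in m<ᵇn
... | false = refl
... | true  = contradiction n≤m (ℕₚ.<⇒≱ (ℕₚ.<ᵇ⇒< m n (Equivalence.from Boolₚ.T-≡ m<ᵇn)))

compareᵇ : ∀ x y → Comparisonᵇ x y
compareᵇ x y with ℕₚ.<-cmp x y
... | tri< x<y _ _ = less x<y (<⇒<ᵇ≡true x<y) (≥⇒<ᵇ≡false (ℕₚ.<⇒≤ x<y))
... | tri≈ _ x≡y _ = equal x≡y
... | tri> _ _ y<x = greater y<x (≥⇒<ᵇ≡false (ℕₚ.<⇒≤ y<x)) (<⇒<ᵇ≡true y<x)

<ᵇ-irrefl : ∀ x → (x <ᵇ x) ≡ false
<ᵇ-irrefl x = ≥⇒<ᵇ≡false {x} ℕₚ.≤-refl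

<ᵇ-∧-≥ : ∀ x y z → z ≤ x → ((x <ᵇ y) ∧ (y <ᵇ z)) ≡ false
<ᵇ-∧-≥ x y z z≤x with x <ᵇ y in x<ᵇy
... | false = refl
... | true  = ≥⇒<ᵇ≡false (ℕₚ.≤-trans z≤x (ℕₚ.<⇒≤ (ℕₚ.<ᵇ⇒< x y (Equivalence.from Boolₚ.T-≡ x<ᵇy))))

<ᵇ-asym : ∀ x y → ((x <ᵇ y) ∧ (y <ᵇ x)) ≡ false
<ᵇ-asym x y = <ᵇ-∧-≥ x y x ℕₚ.≤-refl

_<ᶠ_ : ∀ {n} → Fin n → Fin n → Bool
i <ᶠ j = toℕ i <ᵇ toℕ j

doubleProd : ∀ {n} → (Fin n → Fin n → Sign) → Sign
doubleProd {n} f = prodSign (map (λ i → prodSign (map (f i) (allFin n))) (allFin n))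

doubleProd-· : ∀ {n} (f g : Fin n → Fin n → Sign) → doubleProd (λ i j → f i j · g i j) ≡ doubleProd f · doubleProd g
doubleProd-· {n} f g =
  trans (ProdSign.fold-map-ext (allFin n) (λ i → ProdSign.fold-map-∙ (f i) (g i) (allFin n)))
        (ProdSign.fold-map-∙ _ _ (allFin n))

doubleProd-cong : ∀ {n} {f g : Fin n → Fin n → Sign} → (∀ i j → f i j ≡ g i j) → doubleProd f ≡ doubleProd g
doubleProd-cong {n} f≡g = ProdSign.fold-map-ext (allFin n) (λ i → ProdSign.fold-map-ext (allFin n) (f≡g i))

doubleProd-flip : ∀ {n} (f : Fin n → Fin n → Sign) → doubleProd (λ i j → f j i) ≡ doubleProd f
doubleProd-flip {n} f = ProdSign.fold-map-comm (λ i j → f j i) (allFin n) (allFin n)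

prodSign-allFin-bijection : ∀ {n} (σ σ⁻¹ : Fin n → Fin n) → (∀ a → σ (σ⁻¹ a) ≡ a) → (∀ a → σ⁻¹ (σ a) ≡ a) →
  (g : Fin n → Sign) → prodSign (map (g ∘ σ) (allFin n)) ≡ prodSign (map g (allFin n))
prodSign-allFin-bijection {n} σ σ⁻¹ σσ⁻¹ σ⁻¹σ g =
  ProdSign.fold-map-bijection g σ σ⁻¹ σσ⁻¹ σ⁻¹σ (Uniqueₚ.allFin⁺ n) ∈-allFin

doubleProd-bijection : ∀ {n} (σ σ⁻¹ : Fin n → Fin n) → (∀ a → σ (σ⁻¹ a) ≡ a) → (∀ a → σ⁻¹ (σ a) ≡ a) →
  (g : Fin n → Fin n → Sign) → doubleProd (λ i j → g (σ i) (σ j)) ≡ doubleProd g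
doubleProd-bijection {n} σ σ⁻¹ σσ⁻¹ σ⁻¹σ g =
  trans (ProdSign.fold-map-ext (allFin n) (λ i → prodSign-allFin-bijection σ σ⁻¹ σσ⁻¹ σ⁻¹σ (g (σ i))))
        (prodSign-allFin-bijection σ σ⁻¹ σσ⁻¹ σ⁻¹σ (λ u → prodSign (map (g u) (allFin n))))

sgn : ∀ {n} → (Fin n → Fin n) → Sign
sgn π = doubleProd (λ i j → neg1^ᵇ ((i <ᶠ j) ∧ (π j <ᶠ π i)))

neg1^-inversions : ∀ {n} (π : Fin n → Fin n) → neg1^ (inversions π) ≡ signToℤ (sgn π)
neg1^-inversions {n} π = begin
  neg1^ (inversions π)
    ≡⟨ neg1^-count id (concatMap row (allFin n)) ⟩
  signToℤ (prodSign (map neg1^ᵇ (concatMap row (allFin n))))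
    ≡⟨ cong signToℤ (ProdSign.fold-concatMap row neg1^ᵇ (allFin n)) ⟩
  signToℤ (prodSign (map (λ i → prodSign (map neg1^ᵇ (row i))) (allFin n)))
    ≡⟨ cong signToℤ (ProdSign.fold-map-ext (allFin n) (λ i → cong prodSign (List.map-∘ (allFin n)))) ⟨
  signToℤ (sgn π) ∎
  where
    open ≡-Reasoning
    row : Fin n → List Bool
    row i = map (λ j → (i <ᶠ j) ∧ (π j <ᶠ π i)) (allFin n)

sgn-cong : ∀ {n} {π π′ : Fin n → Fin n} → π ≗ π′ → sgn π ≡ sgn π′
sgn-cong π≗π′ = doubleProd-cong (λ i j → cong₂ (λ u v → neg1^ᵇ ((i <ᶠ j) ∧ (u <ᶠ v))) (π≗π′ j) (π≗π′ i))

sgn-id : ∀ {n} (π : Fin n → Fin n) → π ≗ id → sgn π ≡ Sign.+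
sgn-id {n} π π≗id = trans (doubleProd-cong no-inversion)
  (trans (ProdSign.fold-map-ext (allFin n) (λ _ → ProdSign.fold-map-ε (allFin n))) (ProdSign.fold-map-ε (allFin n)))
  where
    no-inversion : ∀ i j → neg1^ᵇ ((i <ᶠ j) ∧ (π j <ᶠ π i)) ≡ Sign.+
    no-inversion i j rewrite π≗id i | π≗id j | <ᵇ-asym (toℕ i) (toℕ j) = refl

-- With Q and R the pairs i < j that σ keeps in order, resp. inverts, and whose σ-images π inverts:
-- inv (π ∘ σ) + |R| = inv σ + |Q| and |Q| + |R| = inv π.
module _ {n} (π σ σ⁻¹ : Fin n → Fin n) (π-injective : Injective _≡_ _≡_ π)
         (σσ⁻¹ : ∀ a → σ (σ⁻¹ a) ≡ a) (σ⁻¹σ : ∀ a → σ⁻¹ (σ a) ≡ a) where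

  private
    σ-injective : Injective _≡_ _≡_ σ
    σ-injective {x} {y} σx≡σy = trans (sym (σ⁻¹σ x)) (trans (cong σ⁻¹ σx≡σy) (σ⁻¹σ y))

    L A Q R K : Fin n → Fin n → Sign
    L i j = neg1^ᵇ ((i <ᶠ j) ∧ (π (σ j) <ᶠ π (σ i)))
    A i j = neg1^ᵇ ((i <ᶠ j) ∧ (σ j <ᶠ σ i))
    Q i j = neg1^ᵇ ((i <ᶠ j) ∧ ((σ i <ᶠ σ j) ∧ (π (σ j) <ᶠ π (σ i))))
    R i j = neg1^ᵇ ((j <ᶠ i) ∧ ((σ i <ᶠ σ j) ∧ (π (σ j) <ᶠ π (σ i))))
    K u v = neg1^ᵇ ((u <ᶠ v) ∧ (π v <ᶠ π u))

    ≢⇒toℕ-≢ : ∀ {u v : Fin n} → u ≢ v → toℕ u ≢ toℕ v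
    ≢⇒toℕ-≢ u≢v = u≢v ∘ toℕ-injective

    opposite-comparisons : ∀ x y → x ≢ y → neg1^ᵇ (y <ᵇ x) · neg1^ᵇ (x <ᵇ y) ≡ Sign.-
    opposite-comparisons x y x≢y with compareᵇ x y
    ... | less    _ x<ᵇy y<ᵇx rewrite x<ᵇy | y<ᵇx = refl
    ... | equal   x≡y                         = contradiction x≡y x≢y
    ... | greater _ x<ᵇy y<ᵇx rewrite x<ᵇy | y<ᵇx = refl

    LR≡AQ : ∀ i j → L i j · R j i ≡ A i j · Q i j
    LR≡AQ i j with compareᵇ (toℕ i) (toℕ j)
    LR≡AQ i j | less i<j i<ᵇj _ rewrite i<ᵇj with compareᵇ (toℕ (σ i)) (toℕ (σ j))
    ... | less _ σi<ᵇσj σj<ᵇσi rewrite σi<ᵇσj | σj<ᵇσi = Sign.*-identityʳ _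
    ... | equal σi≡σj = contradiction (cong toℕ (σ-injective (toℕ-injective σi≡σj))) (ℕₚ.<⇒≢ i<j)
    ... | greater _ σi<ᵇσj σj<ᵇσi rewrite σi<ᵇσj | σj<ᵇσi =
          opposite-comparisons (toℕ (π (σ i))) (toℕ (π (σ j)))
            (≢⇒toℕ-≢ (λ e → ℕₚ.<⇒≢ i<j (cong toℕ (σ-injective (π-injective e)))))
    LR≡AQ i j | equal i≡j with toℕ-injective i≡j
    ... | refl rewrite <ᵇ-irrefl (toℕ i) = refl
    LR≡AQ i j | greater _ i<ᵇj _ rewrite i<ᵇj = refl

    QR≡K : ∀ i j → Q i j · R i j ≡ K (σ i) (σ j)
    QR≡K i j with compareᵇ (toℕ i) (toℕ j)
    ... | less    _ i<ᵇj j<ᵇi rewrite i<ᵇj | j<ᵇi = Sign.*-identityʳ _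
    ... | greater _ i<ᵇj j<ᵇi rewrite i<ᵇj | j<ᵇi = refl
    QR≡K i j | equal i≡j with toℕ-injective i≡j
    ... | refl rewrite <ᵇ-irrefl (toℕ i) | <ᵇ-irrefl (toℕ (σ i)) = refl

    combine : ∀ l r a q s → l · r ≡ a · q → q · r ≡ s → l ≡ a · s
    combine l r a q s lr≡aq qr≡s = begin
      l             ≡⟨ Sign.*-identityʳ l ⟨
      l · Sign.+    ≡⟨ cong (l ·_) (Sign.s*s≡+ r) ⟨
      l · (r · r)   ≡⟨ Sign.*-assoc l r r ⟨
      (l · r) · r   ≡⟨ cong (_· r) lr≡aq ⟩
      (a · q) · r   ≡⟨ Sign.*-assoc a q r ⟩
      a · (q · r)   ≡⟨ cong (a ·_) qr≡s ⟩
      a · s ∎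
      where open ≡-Reasoning

  sgn-∘ : sgn (π ∘ σ) ≡ sgn σ · sgn π
  sgn-∘ = combine (doubleProd L) (doubleProd R) (doubleProd A) (doubleProd Q) (sgn π)
    (begin
      doubleProd L · doubleProd R               ≡⟨ cong (doubleProd L ·_) (doubleProd-flip R) ⟨
      doubleProd L · doubleProd (λ i j → R j i) ≡⟨ doubleProd-· L (λ i j → R j i) ⟨
      doubleProd (λ i j → L i j · R j i)        ≡⟨ doubleProd-cong LR≡AQ ⟩
      doubleProd (λ i j → A i j · Q i j)        ≡⟨ doubleProd-· A Q ⟩
      doubleProd A · doubleProd Q ∎)
    (begin
      doubleProd Q · doubleProd R               ≡⟨ doubleProd-· Q R ⟨
      doubleProd (λ i j → Q i j · R i j)        ≡⟨ doubleProd-cong QR≡K ⟩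
      doubleProd (λ i j → K (σ i) (σ j))        ≡⟨ doubleProd-bijection σ σ⁻¹ σσ⁻¹ σ⁻¹σ K ⟩
      sgn π ∎)
    where open ≡-Reasoning

data TransposeView {n} (a b k : Fin n) : Set where
  at-a      : k ≡ a → transpose a b k ≡ b → TransposeView a b k
  at-b      : k ≢ a → k ≡ b → transpose a b k ≡ a → TransposeView a b k
  elsewhere : k ≢ a → k ≢ b → transpose a b k ≡ k → TransposeView a b k

transpose-a : ∀ {n} (a b : Fin n) → transpose a b a ≡ b
transpose-a a b rewrite dec-true (a ≟ a) refl = refl

transposeView : ∀ {n} (a b k : Fin n) → TransposeView a b k
transposeView a b k with k ≟ a | k ≟ b
... | yes refl | _        = at-a refl (transpose-a a b)
... | no k≢a   | yes refl = at-b k≢a refl (at-b-value k≢a)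
  where
    at-b-value : k ≢ a → transpose a k k ≡ a
    at-b-value k≢a rewrite dec-false (k ≟ a) k≢a | dec-true (k ≟ k) refl = refl
... | no k≢a   | no k≢b   = elsewhere k≢a k≢b fixed
  where
    fixed : transpose a b k ≡ k
    fixed rewrite dec-false (k ≟ a) k≢a | dec-false (k ≟ b) k≢b = refl

transpose-b : ∀ {n} (a b : Fin n) → transpose a b b ≡ a
transpose-b a b with transposeView a b b
... | at-a b≡a τb≡b   = trans τb≡b b≡a
... | at-b _ _ τb≡a   = τb≡a
... | elsewhere _ b≢b _ = contradiction refl b≢b

transpose-involutive : ∀ {n} (a b k : Fin n) → transpose a b (transpose a b k) ≡ k
transpose-involutive a b k with transposeView a b k
... | at-a refl τk≡b     = trans (cong (transpose a b) τk≡b) (transpose-b a b)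
... | at-b _ refl τk≡a   = trans (cong (transpose a b) τk≡a) (transpose-a a b)
... | elsewhere _ _ τk≡k = trans (cong (transpose a b) τk≡k) τk≡k

transpose-comm : ∀ {n} (a b k : Fin n) → transpose a b k ≡ transpose b a k
transpose-comm a b k = begin
  transpose a b k                                 ≡⟨ cong (transpose a b) (transpose-involutive b a k) ⟨
  transpose a b (transpose b a (transpose b a k)) ≡⟨ transpose-inverse a b ⟩
  transpose b a k ∎
  where open ≡-Reasoning

Injective-∘-transpose : ∀ {n} {π : Fin n → Fin n} (a b : Fin n) → Injective _≡_ _≡_ π →
  Injective _≡_ _≡_ (π ∘ transpose a b)
Injective-∘-transpose {π = π} a b π-injective {x} {y} πτx≡πτy = begin
  x                                ≡⟨ transpose-involutive a b x ⟨
  transpose a b (transpose a b x)  ≡⟨ cong (transpose a b) (π-injective πτx≡πτy) ⟩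
  transpose a b (transpose a b y)  ≡⟨ transpose-involutive a b y ⟩
  y ∎
  where open ≡-Reasoning

-- The inversions of (a b), for a < b, are (a , b) and the pairs (a , j), (j , b) with a < j < b.
module _ {n} (a b : Fin n) (a<b : toℕ a < toℕ b) where

  private
    a≢b : a ≢ b
    a≢b a≡b = ℕₚ.<-irrefl (cong toℕ a≡b) a<b

    between : Fin n → Bool
    between j = (a <ᶠ j) ∧ (j <ᶠ b)

    Inv Left Right Corner : Fin n → Fin n → Sign
    Inv i j    = neg1^ᵇ ((i <ᶠ j) ∧ (transpose a b j <ᶠ transpose a b i))
    Left i j   = neg1^ᵇ (does (i ≟ a) ∧ between j)
    Right i j  = neg1^ᵇ (between i ∧ does (j ≟ b))
    Corner i j = neg1^ᵇ (does (i ≟ a) ∧ does (j ≟ b))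

    a<ᶠb : (a <ᶠ b) ≡ true
    a<ᶠb = <⇒<ᵇ≡true a<b

    b<ᶠa : (b <ᶠ a) ≡ false
    b<ᶠa = ≥⇒<ᵇ≡false (ℕₚ.<⇒≤ a<b)

    <ᵇ-∧-≥′ : ∀ x y z → y ≤ z → ((x <ᵇ y) ∧ (z <ᵇ x)) ≡ false
    <ᵇ-∧-≥′ x y z y≤z = trans (Boolₚ.∧-comm (x <ᵇ y) (z <ᵇ x)) (<ᵇ-∧-≥ z x y y≤z)

    Inv-split : ∀ i j → Inv i j ≡ Left i j · (Right i j · Corner i j)
    Inv-split i j with transposeView a b i | transposeView a b j
    ... | at-a refl τi | at-a refl τj
      rewrite τi | <ᵇ-irrefl (toℕ a) | dec-true (a ≟ a) refl | dec-false (a ≟ b) a≢b = refl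
    ... | at-a refl τi | at-b _ refl τj
      rewrite τi | τj | a<ᶠb | <ᵇ-irrefl (toℕ b) | <ᵇ-irrefl (toℕ a)
            | dec-true (a ≟ a) refl | dec-true (b ≟ b) refl = refl
    ... | at-a refl τi | elsewhere _ j≢b τj
      rewrite τi | τj | <ᵇ-irrefl (toℕ a) | dec-true (a ≟ a) refl | dec-false (j ≟ b) j≢b = sym (Sign.*-identityʳ _)
    ... | at-b i≢a refl τi | at-a refl τj
      rewrite τi | τj | b<ᶠa | dec-false (i ≟ a) i≢a | a<ᶠb | <ᵇ-irrefl (toℕ b) = refl
    ... | at-b i≢a refl τi | at-b _ refl τj
      rewrite τi | <ᵇ-irrefl (toℕ b) | dec-false (i ≟ a) i≢a | a<ᶠb = refl
    ... | at-b i≢a refl τi | elsewhere _ j≢b τj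
      rewrite τi | τj | <ᵇ-∧-≥ (toℕ b) (toℕ j) (toℕ a) (ℕₚ.<⇒≤ a<b) | dec-false (i ≟ a) i≢a | a<ᶠb
            | <ᵇ-irrefl (toℕ b) = refl
    ... | elsewhere i≢a i≢b τi | at-a refl τj
      rewrite τi | τj | <ᵇ-∧-≥′ (toℕ i) (toℕ a) (toℕ b) (ℕₚ.<⇒≤ a<b) | dec-false (i ≟ a) i≢a
            | dec-false (a ≟ b) a≢b | Boolₚ.∧-zeroʳ (between i) = refl
    ... | elsewhere i≢a i≢b τi | at-b _ refl τj
      rewrite τi | τj | dec-false (i ≟ a) i≢a | dec-true (b ≟ b) refl | Boolₚ.∧-identityʳ (between i)
            | Boolₚ.∧-comm (a <ᶠ i) (i <ᶠ b) = sym (Sign.*-identityʳ _)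
    ... | elsewhere i≢a i≢b τi | elsewhere _ j≢b τj
      rewrite τi | τj | <ᵇ-asym (toℕ i) (toℕ j) | dec-false (i ≟ a) i≢a | dec-false (j ≟ b) j≢b
            | Boolₚ.∧-zeroʳ (between i) = refl

    prodSign-guarded : ∀ β (γ : Fin n → Bool) →
      prodSign (map (λ j → neg1^ᵇ (β ∧ γ j)) (allFin n))
        ≡ (if β then prodSign (map (neg1^ᵇ ∘ γ) (allFin n)) else Sign.+)
    prodSign-guarded true  γ = refl
    prodSign-guarded false γ = ProdSign.fold-map-ε (allFin n)

    if-neg1^ᵇ : ∀ β → (if β then Sign.- else Sign.+) ≡ neg1^ᵇ β
    if-neg1^ᵇ true  = refl
    if-neg1^ᵇ false = refl

    prodSign-≟ : ∀ c → prodSign (map (λ j → neg1^ᵇ (does (j ≟ c))) (allFin n)) ≡ Sign.-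
    prodSign-≟ c = trans
      (ProdSign.fold-map-unique (λ j → neg1^ᵇ (does (j ≟ c))) c (Uniqueₚ.allFin⁺ n) (∈-allFin c)
        (λ j _ j≢c → cong neg1^ᵇ (dec-false (j ≟ c) j≢c)))
      (cong neg1^ᵇ (dec-true (c ≟ c) refl))

    B : Sign
    B = prodSign (map (neg1^ᵇ ∘ between) (allFin n))

    Left-prod : doubleProd Left ≡ B
    Left-prod = trans (ProdSign.fold-map-ext (allFin n) (λ i → prodSign-guarded (does (i ≟ a)) between))
      (trans (ProdSign.fold-map-unique _ a (Uniqueₚ.allFin⁺ n) (∈-allFin a)
               (λ i _ i≢a → cong (λ t → if t then B else Sign.+) (dec-false (i ≟ a) i≢a)))
             (cong (λ t → if t then B else Sign.+) (dec-true (a ≟ a) refl)))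

    Right-prod : doubleProd Right ≡ B
    Right-prod = ProdSign.fold-map-ext (allFin n) (λ i →
      trans (prodSign-guarded (between i) (λ j → does (j ≟ b)))
            (trans (cong (λ t → if between i then t else Sign.+) (prodSign-≟ b)) (if-neg1^ᵇ (between i))))

    Corner-prod : doubleProd Corner ≡ Sign.-
    Corner-prod = trans (ProdSign.fold-map-ext (allFin n) (λ i →
      trans (prodSign-guarded (does (i ≟ a)) (λ j → does (j ≟ b)))
            (trans (cong (λ t → if does (i ≟ a) then t else Sign.+) (prodSign-≟ b)) (if-neg1^ᵇ (does (i ≟ a))))))
      (prodSign-≟ a)

  sgn-transpose-< : sgn (transpose a b) ≡ Sign.-
  sgn-transpose-< = begin
    doubleProd Inv
      ≡⟨ doubleProd-cong Inv-split ⟩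
    doubleProd (λ i j → Left i j · (Right i j · Corner i j))
      ≡⟨ doubleProd-· Left _ ⟩
    doubleProd Left · doubleProd (λ i j → Right i j · Corner i j)
      ≡⟨ cong (doubleProd Left ·_) (doubleProd-· Right Corner) ⟩
    doubleProd Left · (doubleProd Right · doubleProd Corner)
      ≡⟨ cong₂ (λ u v → u · (v · doubleProd Corner)) Left-prod Right-prod ⟩
    B · (B · doubleProd Corner)
      ≡⟨ Sign.*-assoc B B _ ⟨
    (B · B) · doubleProd Corner
      ≡⟨ cong₂ _·_ (Sign.s*s≡+ B) Corner-prod ⟩
    Sign.- ∎
    where open ≡-Reasoning

sgn-transpose : ∀ {n} (a b : Fin n) → a ≢ b → sgn (transpose a b) ≡ Sign.-
sgn-transpose a b a≢b with compareᵇ (toℕ a) (toℕ b)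
... | less    a<b _ _ = sgn-transpose-< a b a<b
... | equal   a≡b     = contradiction (toℕ-injective a≡b) a≢b
... | greater b<a _ _ = trans (sgn-cong (transpose-comm a b)) (sgn-transpose-< b a b<a)

sgn-∘-transpose : ∀ {n} (π : Fin n → Fin n) → Injective _≡_ _≡_ π → (a b : Fin n) → a ≢ b →
  sgn (π ∘ transpose a b) ≡ Sign.- · sgn π
sgn-∘-transpose π π-injective a b a≢b =
  trans (sgn-∘ π (transpose a b) (transpose a b) π-injective (transpose-involutive a b) (transpose-involutive a b))
        (cong (_· sgn π) (sgn-transpose a b a≢b))

-- Cycles of a permutation

infix 4 _↝[_]_
_↝[_]_ : ∀ {n} → Fin n → (Fin n → Fin n) → Fin n → Set
x ↝[ π ] y = ∃[ k ] iter π k x ≡ y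

iter-+ : ∀ {n} (π : Fin n → Fin n) k m x → iter π (k ℕ.+ m) x ≡ iter π k (iter π m x)
iter-+ π zero    m x = refl
iter-+ π (suc k) m x = cong π (iter-+ π k m x)

iter-*-return : ∀ {n} (π : Fin n → Fin n) {x} p → iter π p x ≡ x → ∀ m → iter π (m ℕ.* p) x ≡ x
iter-*-return π p returns zero    = refl
iter-*-return π p returns (suc m) =
  trans (iter-+ π p (m ℕ.* p) _) (trans (cong (iter π p) (iter-*-return π p returns m)) returns)

module _ {n} {π : Fin n → Fin n} where

  ↝-refl : ∀ {x} → x ↝[ π ] x
  ↝-refl = 0 , refl

  ↝-step : ∀ x → x ↝[ π ] π x
  ↝-step x = 1 , refl

  ↝-trans : ∀ {x y z} → x ↝[ π ] y → y ↝[ π ] z → x ↝[ π ] z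
  ↝-trans (k , πᵏx≡y) (m , πᵐy≡z) = m ℕ.+ k , trans (iter-+ π m k _) (trans (cong (iter π m) πᵏx≡y) πᵐy≡z)

module Cycles {n} (π : Fin n → Fin n) (π-injective : Injective _≡_ _≡_ π) where

  iter-injective : ∀ k {x y} → iter π k x ≡ iter π k y → x ≡ y
  iter-injective zero    πᵏx≡πᵏy = πᵏx≡πᵏy
  iter-injective (suc k) πᵏx≡πᵏy = iter-injective k (π-injective πᵏx≡πᵏy)

  -- Among x, π x, …, πⁿ x two coincide (pigeonhole), and injectivity cancels the common prefix.
  return-time : ∀ x → ∃[ p ] 0 < p × p ≤ n × iter π p x ≡ x
  return-time x with pigeonhole (ℕₚ.n<1+n n) (λ (i : Fin (suc n)) → iter π (toℕ i) x)
  ... | i , j , i<j , πⁱx≡πʲx = toℕ j ∸ toℕ i , ℕₚ.m<n⇒0<n∸m i<j ,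
      ℕₚ.≤-trans (ℕₚ.m∸n≤m (toℕ j) (toℕ i)) (ℕₚ.≤-pred (toℕ<n j)) , iter-injective (toℕ i) (sym (begin
      iter π (toℕ i) x                          ≡⟨ πⁱx≡πʲx ⟩
      iter π (toℕ j) x                          ≡⟨ cong (λ t → iter π t x) (ℕₚ.m+[n∸m]≡n (ℕₚ.<⇒≤ i<j)) ⟨
      iter π (toℕ i ℕ.+ (toℕ j ∸ toℕ i)) x      ≡⟨ iter-+ π (toℕ i) (toℕ j ∸ toℕ i) x ⟩
      iter π (toℕ i) (iter π (toℕ j ∸ toℕ i) x) ∎))
    where open ≡-Reasoning

  ↝-sym : ∀ {x y} → x ↝[ π ] y → y ↝[ π ] x
  ↝-sym {x} {y} (k , πᵏx≡y) with return-time x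
  ... | suc q , _ , _ , returns = k ℕ.* q , (begin
      iter π (k ℕ.* q) y             ≡⟨ cong (iter π (k ℕ.* q)) πᵏx≡y ⟨
      iter π (k ℕ.* q) (iter π k x)  ≡⟨ iter-+ π (k ℕ.* q) k x ⟨
      iter π (k ℕ.* q ℕ.+ k) x       ≡⟨ cong (λ t → iter π t x) (ℕₚ.+-comm (k ℕ.* q) k) ⟩
      iter π (k ℕ.+ k ℕ.* q) x       ≡⟨ cong (λ t → iter π t x) (ℕₚ.*-suc k q) ⟨
      iter π (k ℕ.* suc q) x         ≡⟨ iter-*-return π (suc q) returns k ⟩
      x ∎)
    where open ≡-Reasoning

  ↝-within-n : ∀ {x y} → x ↝[ π ] y → ∃[ k ] k < n × iter π k x ≡ y
  ↝-within-n {x} {y} (k , πᵏx≡y) with return-time x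
  ... | p@(suc _) , _ , p≤n , returns = k % p , ℕₚ.<-≤-trans (m%n<n k p) p≤n , (begin
      iter π (k % p) x                            ≡⟨ cong (iter π (k % p)) (iter-*-return π p returns (k / p)) ⟨
      iter π (k % p) (iter π ((k / p) ℕ.* p) x)   ≡⟨ iter-+ π (k % p) ((k / p) ℕ.* p) x ⟨
      iter π (k % p ℕ.+ (k / p) ℕ.* p) x          ≡⟨ cong (λ t → iter π t x) (m≡m%n+[m/n]*n k p) ⟨
      iter π k x                                  ≡⟨ πᵏx≡y ⟩
      y ∎)
    where open ≡-Reasoning

  inCycle⇒↝ : ∀ {x y} → inCycle π x y ≡ true → x ↝[ π ] y
  inCycle⇒↝ {x} {y} inCycle≡true with any≡true⇒∃ (λ k → iter π k x == y) (upTo n) inCycle≡true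
  ... | k , _ , πᵏx==y = k , ==⇒≡ πᵏx==y

  ↝⇒inCycle : ∀ {x y} → x ↝[ π ] y → inCycle π x y ≡ true
  ↝⇒inCycle x↝y with ↝-within-n x↝y
  ... | k , k<n , πᵏx≡y = ∃⇒any≡true _ (upTo n) (∈-upTo⁺ k<n) (≡⇒== πᵏx≡y)

  _↝?_ : ∀ x y → Dec (x ↝[ π ] y)
  x ↝? y with inCycle π x y in inCycle≡
  ... | true  = yes (inCycle⇒↝ inCycle≡)
  ... | false = no (λ x↝y → contradiction (trans (sym inCycle≡) (↝⇒inCycle x↝y)) λ ())

  ∈cycleOf⇒↝ : ∀ {x y} → y ∈ cycleOf π x → x ↝[ π ] y
  ∈cycleOf⇒↝ {x} y∈ = inCycle⇒↝ (proj₂ (∈-filter⁻ (λ w → inCycle π x w Bool.≟ true) {xs = allFin n} y∈))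

  ↝⇒∈cycleOf : ∀ {x y} → x ↝[ π ] y → y ∈ cycleOf π x
  ↝⇒∈cycleOf {x} {y} x↝y = ∈-filter⁺ (λ w → inCycle π x w Bool.≟ true) (∈-allFin y) (↝⇒inCycle x↝y)

  isRep⇒minimal : ∀ {v} → isRep π v ≡ true → ∀ {w} → v ↝[ π ] w → toℕ v ≤ toℕ w
  isRep⇒minimal {v} isRep≡true v↝w =
    ℕₚ.≤ᵇ⇒≤ _ _ (Equivalence.from Boolₚ.T-≡ (all≡true⇒∀ (λ w → toℕ v ≤ᵇ toℕ w) (cycleOf π v) isRep≡true (↝⇒∈cycleOf v↝w)))

  minimal⇒isRep : ∀ {v} → (∀ {w} → v ↝[ π ] w → toℕ v ≤ toℕ w) → isRep π v ≡ true
  minimal⇒isRep {v} minimal = ∀⇒all≡true (λ w → toℕ v ≤ᵇ toℕ w) (cycleOf π v)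
    (λ w∈ → Equivalence.to Boolₚ.T-≡ (ℕₚ.≤⇒≤ᵇ (minimal (∈cycleOf⇒↝ w∈))))

  ¬isRep⇒smaller : ∀ {v} → isRep π v ≡ false → ∃[ w ] v ↝[ π ] w × toℕ w < toℕ v
  ¬isRep⇒smaller {v} isRep≡false with all≡false⇒∃ (λ w → toℕ v ≤ᵇ toℕ w) (cycleOf π v) isRep≡false
  ... | w , w∈ , v≰ᵇw = w , ∈cycleOf⇒↝ w∈ ,
        ℕₚ.≰⇒> (λ v≤w → contradiction (trans (sym (Equivalence.to Boolₚ.T-≡ (ℕₚ.≤⇒≤ᵇ v≤w))) v≰ᵇw) λ ())

  isRep-unique : ∀ {x y} → isRep π x ≡ true → isRep π y ≡ true → x ↝[ π ] y → x ≡ y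
  isRep-unique x-rep y-rep x↝y = toℕ-injective (ℕₚ.≤-antisym (isRep⇒minimal x-rep x↝y) (isRep⇒minimal y-rep (↝-sym x↝y)))

  isRep-fixedPoint : ∀ {v} → π v ≡ v → isRep π v ≡ true
  isRep-fixedPoint {v} πv≡v = minimal⇒isRep (λ (k , πᵏv≡w) → ℕₚ.≤-reflexive (cong toℕ (trans (sym (fixed k)) πᵏv≡w)))
    where
      fixed : ∀ k → iter π k v ≡ v
      fixed zero    = refl
      fixed (suc k) = trans (cong π (fixed k)) πv≡v

  representative : ∀ w → ∃[ v ] isRep π v ≡ true × v ↝[ π ] w
  representative w = m , minimal⇒isRep m-minimal , ↝-sym w↝m
    where
      m : Fin n
      m = argmin toℕ w (cycleOf π w)
      w↝m : w ↝[ π ] m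
      w↝m = argmin-all toℕ ↝-refl (All.tabulate ∈cycleOf⇒↝)
      m-minimal : ∀ {u} → m ↝[ π ] u → toℕ m ≤ toℕ u
      m-minimal m↝u = All.lookup (f[argmin]≤f[xs] w (cycleOf π w)) (↝⇒∈cycleOf (↝-trans w↝m m↝u))

  -- Each w lies on the cycle of exactly one representative.
  prodSign-cycles : ∀ (s : Fin n → Sign) → prodSign (map s (allFin n))
    ≡ prodSign (map (λ v → if isRep π v then prodSign (map s (cycleOf π v)) else Sign.+) (allFin n))
  prodSign-cycles s = sym (begin
    prodSign (map (λ v → if isRep π v then prodSign (map s (cycleOf π v)) else Sign.+) (allFin n))
      ≡⟨ ProdSign.fold-map-ext (allFin n) row ⟩
    prodSign (map (λ v → prodSign (map (G v) (allFin n))) (allFin n))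
      ≡⟨ ProdSign.fold-map-comm G (allFin n) (allFin n) ⟩
    prodSign (map (λ w → prodSign (map (λ v → G v w) (allFin n))) (allFin n))
      ≡⟨ ProdSign.fold-map-ext (allFin n) column ⟩
    prodSign (map s (allFin n)) ∎)
    where
      open ≡-Reasoning
      G : Fin n → Fin n → Sign
      G v w = if isRep π v ∧ inCycle π v w then s w else Sign.+

      row : ∀ v → (if isRep π v then prodSign (map s (cycleOf π v)) else Sign.+) ≡ prodSign (map (G v) (allFin n))
      row v with isRep π v
      ... | true  = trans (ProdSign.fold-filter (λ w → inCycle π v w Bool.≟ true) s (allFin n))
                          (ProdSign.fold-map-ext (allFin n) (λ w →
                            cong (λ t → if t then s w else Sign.+) (does-≟-true (inCycle π v w))))
      ... | false = sym (ProdSign.fold-map-ε (allFin n))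

      column : ∀ w → prodSign (map (λ v → G v w) (allFin n)) ≡ s w
      column w with representative w
      ... | r , r-rep , r↝w = trans (ProdSign.fold-map-unique (λ v → G v w) r (Uniqueₚ.allFin⁺ n) (∈-allFin r) off-r)
                                    (cong (λ t → if t then s w else Sign.+) (cong₂ _∧_ r-rep (↝⇒inCycle r↝w)))
        where
          off-r : ∀ v → v ∈ allFin n → v ≢ r → G v w ≡ Sign.+
          off-r v _ v≢r with isRep π v in v-rep | inCycle π v w in v-w
          ... | true  | true  = contradiction (isRep-unique v-rep r-rep (↝-trans (inCycle⇒↝ v-w) (↝-sym r↝w))) v≢r
          ... | true  | false = refl
          ... | false | _     = refl

nonRep : ∀ {n} → (Fin n → Fin n) → Fin n → Bool
nonRep π v = not (isRep π v)

count-differ-at : ∀ {B : Set} (p q : B → Bool) {xs} x₀ → Unique xs → x₀ ∈ xs →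
  p x₀ ≡ true → q x₀ ≡ false → (∀ x → x ≢ x₀ → p x ≡ q x) → count p xs ≡ suc (count q xs)
count-differ-at p q {y ∷ xs} x₀ (y∉xs ∷ _) (here refl) px₀ qx₀ p≡q rewrite px₀ | qx₀ =
  cong suc (count-cong xs (λ x x∈xs → p≡q x (λ { refl → All.lookup y∉xs x∈xs refl })))
  where
    count-cong : ∀ xs → (∀ x → x ∈ xs → p x ≡ q x) → count p xs ≡ count q xs
    count-cong []       _   = refl
    count-cong (z ∷ xs) p≡q rewrite p≡q z (here refl) with q z
    ... | true  = cong suc (count-cong xs (λ x → p≡q x ∘ there))
    ... | false = count-cong xs (λ x → p≡q x ∘ there)
count-differ-at p q {y ∷ xs} x₀ (y∉xs ∷ u) (there x₀∈xs) px₀ qx₀ p≡q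
  rewrite p≡q y (λ { refl → All.lookup y∉xs x₀∈xs refl }) with q y
... | true  = cong suc (count-differ-at p q x₀ u x₀∈xs px₀ qx₀ p≡q)
... | false = count-differ-at p q x₀ u x₀∈xs px₀ qx₀ p≡q

prodSign-differ-at : ∀ {B : Set} (f g : B → Sign) {xs} x₀ → Unique xs → x₀ ∈ xs →
  (∀ x → x ≢ x₀ → f x ≡ g x) → prodSign (map f xs) ≡ (f x₀ · g x₀) · prodSign (map g xs)
prodSign-differ-at f g {xs} x₀ unique x₀∈xs f≡g = begin
  F                                   ≡⟨ Sign.*-identityʳ F ⟨
  F · Sign.+                          ≡⟨ cong (F ·_) (Sign.s*s≡+ G) ⟨
  F · (G · G)                         ≡⟨ Sign.*-assoc F G G ⟨
  (F · G) · G                         ≡⟨ cong (_· G) (ProdSign.fold-map-∙ f g xs) ⟨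
  prodSign (map (λ x → f x · g x) xs) · G
    ≡⟨ cong (_· G) (ProdSign.fold-map-unique (λ x → f x · g x) x₀ unique x₀∈xs
         (λ x _ x≢x₀ → trans (cong (_· g x) (f≡g x x≢x₀)) (Sign.s*s≡+ (g x)))) ⟩
  (f x₀ · g x₀) · G ∎
  where
    open ≡-Reasoning
    F G : Sign
    F = prodSign (map f xs)
    G = prodSign (map g xs)

-- For π a ≢ a, the permutation π ∘ (a b) with π b = a cuts a out of its cycle.
module SplitCycle {n} (π : Fin n → Fin n) (π-injective : Injective _≡_ _≡_ π) (a : Fin n) (πa≢a : π a ≢ a) where

  private
    module C = Cycles π π-injective

  abstract
    predecessor : ∃[ b ] π b ≡ a × a ↝[ π ] b
    predecessor with C.return-time a
    ... | suc q , _ , _ , πᵠ⁺¹a≡a = iter π q a , πᵠ⁺¹a≡a , q , refl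

  b : Fin n
  b = proj₁ predecessor

  πb≡a : π b ≡ a
  πb≡a = proj₁ (proj₂ predecessor)

  a↝b : a ↝[ π ] b
  a↝b = proj₂ (proj₂ predecessor)

  a≢b : a ≢ b
  a≢b a≡b = πa≢a (trans (cong π a≡b) πb≡a)

  π′ : Fin n → Fin n
  π′ = π ∘ transpose a b

  π′-injective : Injective _≡_ _≡_ π′
  π′-injective = Injective-∘-transpose a b π-injective

  private
    module C′ = Cycles π′ π′-injective

  π′a≡a : π′ a ≡ a
  π′a≡a = trans (cong π (transpose-a a b)) πb≡a

  π′b≡πa : π′ b ≡ π a
  π′b≡πa = cong π (transpose-b a b)

  π′-elsewhere : ∀ {x} → x ≢ a → x ≢ b → π′ x ≡ π x
  π′-elsewhere {x} x≢a x≢b with transposeView a b x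
  ... | at-a x≡a _         = contradiction x≡a x≢a
  ... | at-b _ x≡b _       = contradiction x≡b x≢b
  ... | elsewhere _ _ τx≡x = cong π τx≡x

  π′-before-a : ∀ {y} → π y ≡ a → π′ y ≡ π (π y)
  π′-before-a {y} πy≡a = begin
    π′ y      ≡⟨ cong π′ (π-injective (trans πy≡a (sym πb≡a))) ⟩
    π′ b      ≡⟨ π′b≡πa ⟩
    π a       ≡⟨ cong π πy≡a ⟨
    π (π y) ∎
    where open ≡-Reasoning

  ↝-π′-step : ∀ y → y ↝[ π ] π′ y
  ↝-π′-step y with transposeView a b y
  ... | at-a refl _        = 0 , sym π′a≡a
  ... | at-b _ refl _      = 2 , trans (cong π πb≡a) (sym π′b≡πa)
  ... | elsewhere _ _ τy≡y = 1 , cong π (sym τy≡y)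

  ↝′⇒↝ : ∀ {x w} → x ↝[ π′ ] w → x ↝[ π ] w
  ↝′⇒↝ (zero  , x≡w)      = 0 , x≡w
  ↝′⇒↝ (suc k , π′ᵏ⁺¹x≡w) = ↝-trans (↝′⇒↝ (k , refl)) (subst (_ ↝[ π ]_) π′ᵏ⁺¹x≡w (↝-π′-step _))

  iter-π′-a : ∀ k → iter π′ k a ≡ a
  iter-π′-a zero    = refl
  iter-π′-a (suc k) = trans (cong π′ (iter-π′-a k)) π′a≡a

  off-cycle-iter : ∀ {x} → ¬ a ↝[ π ] x → ∀ k → iter π′ k x ≡ iter π k x × ¬ a ↝[ π ] iter π k x
  off-cycle-iter a↝̸x zero    = refl , a↝̸x
  off-cycle-iter a↝̸x (suc k) with off-cycle-iter a↝̸x k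
  ... | π′ᵏx≡πᵏx , a↝̸y =
        trans (cong π′ π′ᵏx≡πᵏx) (π′-elsewhere (λ y≡a → a↝̸y (subst (a ↝[ π ]_) (sym y≡a) ↝-refl))
                                               (λ y≡b → a↝̸y (subst (a ↝[ π ]_) (sym y≡b) a↝b))) ,
        λ a↝πy → a↝̸y (C.↝-sym (↝-trans (↝-step _) (C.↝-sym a↝πy)))

  off-cycle-↝⇒↝′ : ∀ {x w} → ¬ a ↝[ π ] x → x ↝[ π ] w → x ↝[ π′ ] w
  off-cycle-↝⇒↝′ a↝̸x (k , πᵏx≡w) = k , trans (proj₁ (off-cycle-iter a↝̸x k)) πᵏx≡w

  -- The π′-orbit of x follows its π-orbit, except that it jumps from b over a to π a.
  avoiding-a-↝⇒↝′ : ∀ {x w} → x ≢ a → x ↝[ π ] w → w ≢ a → x ↝[ π′ ] w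
  avoiding-a-↝⇒↝′ {x} x≢a (k , πᵏx≡w) w≢a =
    subst (x ↝[ π′ ]_) πᵏx≡w (proj₁ (reach k) (λ πᵏx≡a → w≢a (trans (sym πᵏx≡w) πᵏx≡a)))
    where
      reach : ∀ k → (iter π k x ≢ a → x ↝[ π′ ] iter π k x)
                  × (iter π k x ≡ a → x ↝[ π′ ] iter π (suc k) x)
      reach zero    = (λ _ → ↝-refl) , (λ x≡a → contradiction x≡a x≢a)
      reach (suc k) with iter π k x ≟ a
      ... | yes πᵏx≡a = (λ _ → proj₂ (reach k) πᵏx≡a)
                      , (λ πᵏ⁺¹x≡a → contradiction (trans (cong π (sym πᵏx≡a)) πᵏ⁺¹x≡a) πa≢a)
      ... | no  πᵏx≢a = (λ πᵏ⁺¹x≢a → ↝-trans (proj₁ (reach k) πᵏx≢a)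
                          (1 , π′-elsewhere πᵏx≢a (λ πᵏx≡b → πᵏ⁺¹x≢a (trans (cong π πᵏx≡b) πb≡a))))
                      , (λ πᵏ⁺¹x≡a → ↝-trans (proj₁ (reach k) πᵏx≢a) (1 , π′-before-a πᵏ⁺¹x≡a))

  isRep′≡isRep-off-cycle : ∀ {x} → ¬ a ↝[ π ] x → isRep π′ x ≡ isRep π x
  isRep′≡isRep-off-cycle a↝̸x = bool-ext
    (λ rep′ → C.minimal⇒isRep (λ x↝w → C′.isRep⇒minimal rep′ (off-cycle-↝⇒↝′ a↝̸x x↝w)))
    (λ rep → C′.minimal⇒isRep (λ x↝′w → C.isRep⇒minimal rep (↝′⇒↝ x↝′w)))

  isRep′-a : isRep π′ a ≡ true
  isRep′-a = C′.isRep-fixedPoint π′a≡a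

  -- If a was not the representative of its cycle, then a becomes the one new representative.
  isRep′≡isRep-if-¬isRep-a : isRep π a ≡ false → ∀ x → x ≢ a → isRep π′ x ≡ isRep π x
  isRep′≡isRep-if-¬isRep-a a-not-rep x x≢a with a C.↝? x
  ... | no  a↝̸x = isRep′≡isRep-off-cycle a↝̸x
  ... | yes a↝x = bool-ext rep′⇒rep (λ rep → C′.minimal⇒isRep (λ x↝′w → C.isRep⇒minimal rep (↝′⇒↝ x↝′w)))
    where
      rep′⇒rep : isRep π′ x ≡ true → isRep π x ≡ true
      rep′⇒rep rep′ = C.minimal⇒isRep minimal
        where
          minimal : ∀ {w} → x ↝[ π ] w → toℕ x ≤ toℕ w
          minimal {w} x↝w with w ≟ a
          ... | no  w≢a  = C′.isRep⇒minimal rep′ (avoiding-a-↝⇒↝′ x≢a x↝w w≢a)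
          ... | yes refl with C.¬isRep⇒smaller a-not-rep
          ...   | u , a↝u , u<a = ℕₚ.≤-trans
                  (C′.isRep⇒minimal rep′ (avoiding-a-↝⇒↝′ x≢a (↝-trans x↝w a↝u)
                    (λ { refl → ℕₚ.<-irrefl refl u<a })))
                  (ℕₚ.<⇒≤ u<a)

  -- If a was the representative, the rest of its old cycle gets a new one.
  new-representative-if-isRep-a : isRep π a ≡ true →
    ∃[ r ] isRep π′ r ≡ true × isRep π r ≡ false × (∀ x → x ≢ r → isRep π′ x ≡ isRep π x)
  new-representative-if-isRep-a a-rep with C′.representative b
  ... | r , r-rep′ , r↝′b = r , r-rep′ , r-not-rep , unchanged
    where
      r≢a : r ≢ a
      r≢a refl = a≢b (trans (sym (iter-π′-a (proj₁ r↝′b))) (proj₂ r↝′b))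
      a↝r : a ↝[ π ] r
      a↝r = ↝-trans a↝b (C.↝-sym (↝′⇒↝ r↝′b))
      r-not-rep : isRep π r ≡ false
      r-not-rep = Boolₚ.¬-not (λ r-rep → r≢a (sym (C.isRep-unique a-rep r-rep a↝r)))
      unchanged : ∀ x → x ≢ r → isRep π′ x ≡ isRep π x
      unchanged x x≢r with x ≟ a
      ... | yes refl = trans isRep′-a (sym a-rep)
      ... | no  x≢a with a C.↝? x
      ...   | no  a↝̸x = isRep′≡isRep-off-cycle a↝̸x
      ...   | yes a↝x = trans
              (Boolₚ.¬-not (λ rep′ → x≢r (C′.isRep-unique rep′ r-rep′
                (avoiding-a-↝⇒↝′ x≢a (↝-trans (C.↝-sym a↝x) a↝r) r≢a))))
              (sym (Boolₚ.¬-not (λ rep → x≢a (sym (C.isRep-unique a-rep rep a↝x)))))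

  new-representative : ∃[ x₀ ] isRep π′ x₀ ≡ true × isRep π x₀ ≡ false
                               × (∀ x → x ≢ x₀ → isRep π′ x ≡ isRep π x)
  new-representative with isRep π a in a-rep
  ... | false = a , isRep′-a , a-rep , isRep′≡isRep-if-¬isRep-a a-rep
  ... | true  = new-representative-if-isRep-a a-rep

  count-nonRep : count (nonRep π) (allFin n) ≡ suc (count (nonRep π′) (allFin n))
  count-nonRep with new-representative
  ... | x₀ , rep′ , not-rep , unchanged =
    count-differ-at (nonRep π) (nonRep π′) x₀ (Uniqueₚ.allFin⁺ n) (∈-allFin x₀)
      (cong not not-rep) (cong not rep′) (λ x x≢x₀ → cong not (sym (unchanged x x≢x₀)))

  prodSign-nonRep :
    prodSign (map (neg1^ᵇ ∘ nonRep π) (allFin n)) ≡ Sign.- · prodSign (map (neg1^ᵇ ∘ nonRep π′) (allFin n))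
  prodSign-nonRep with new-representative
  ... | x₀ , rep′ , not-rep , unchanged = trans
    (prodSign-differ-at (neg1^ᵇ ∘ nonRep π) (neg1^ᵇ ∘ nonRep π′) x₀ (Uniqueₚ.allFin⁺ n) (∈-allFin x₀)
      (λ x x≢x₀ → cong (neg1^ᵇ ∘ not) (sym (unchanged x x≢x₀))))
    (cong (_· prodSign (map (neg1^ᵇ ∘ nonRep π′) (allFin n)))
      (cong₂ (λ u v → neg1^ᵇ (not u) · neg1^ᵇ (not v)) not-rep rep′))

  sgn-split : sgn π ≡ Sign.- · sgn π′
  sgn-split = sym (begin
    Sign.- · sgn π′             ≡⟨ cong (Sign.- ·_) (sgn-∘-transpose π π-injective a b a≢b) ⟩
    Sign.- · (Sign.- · sgn π)   ≡⟨ Sign.*-assoc Sign.- Sign.- (sgn π) ⟨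
    sgn π ∎)
    where open ≡-Reasoning

-- Each cycle has exactly one representative, so this is (-1) ^ (n - number of cycles).
sgn≡prodSign-nonRep : ∀ {n} (π : Fin n → Fin n) → Injective _≡_ _≡_ π →
  sgn π ≡ prodSign (map (neg1^ᵇ ∘ nonRep π) (allFin n))
sgn≡prodSign-nonRep {n} π π-injective = by-count _ π π-injective refl
  where
    by-count : ∀ k (π : Fin n → Fin n) → Injective _≡_ _≡_ π → count (nonRep π) (allFin n) ≡ k →
      sgn π ≡ prodSign (map (neg1^ᵇ ∘ nonRep π) (allFin n))
    by-count k π π-injective count≡k with any? (λ a → ¬? (π a ≟ a))
    ... | no no-moved = trans (sgn-id π fixed) (sym (trans
            (ProdSign.fold-map-ext (allFin n) (λ v →
              cong (neg1^ᵇ ∘ not) (Cycles.isRep-fixedPoint π π-injective (fixed v))))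
            (ProdSign.fold-map-ε (allFin n))))
      where
        fixed : π ≗ id
        fixed x = decidable-stable (π x ≟ x) (λ πx≢x → no-moved (x , πx≢x))
    ... | yes (a , πa≢a) with k
    ...   | zero  = contradiction (trans (sym count-nonRep) count≡k) λ ()
      where open SplitCycle π π-injective a πa≢a
    ...   | suc k = begin
      sgn π                                                   ≡⟨ sgn-split ⟩
      Sign.- · sgn π′                                         ≡⟨ cong (Sign.- ·_) (by-count k π′ π′-injective count′≡k) ⟩
      Sign.- · prodSign (map (neg1^ᵇ ∘ nonRep π′) (allFin n)) ≡⟨ prodSign-nonRep ⟨
      prodSign (map (neg1^ᵇ ∘ nonRep π) (allFin n)) ∎
      where
        open ≡-Reasoning
        open SplitCycle π π-injective a πa≢a
        count′≡k : count (nonRep π′) (allFin n) ≡ k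
        count′≡k = ℕₚ.suc-injective (trans (sym count-nonRep) count≡k)

weight : ∀ {n} → Matrix± n → (f π : Fin n → Fin n) → Sign
weight {n} H f π = prodSign (map (λ i → H i (f i) · H (π i) (f i)) (allFin n))

expansionTerm≡signToℤ : ∀ {n} (H : Matrix± n) (f π : Fin n → Fin n) →
  expansionTerm H f π ≡ signToℤ (sgn π · weight H f π)
expansionTerm≡signToℤ {n} H f π = begin
  neg1^ (inversions π) * prodℤ (map (λ i → signToℤ (H i (f i)) * signToℤ (H (π i) (f i))) (allFin n))
    ≡⟨ cong₂ _*_ (neg1^-inversions π)
                 (Prodℤ.fold-map-ext (allFin n) (λ i → sym (signToℤ-· (H i (f i)) (H (π i) (f i))))) ⟩
  signToℤ (sgn π) * prodℤ (map (λ i → signToℤ (H i (f i) · H (π i) (f i))) (allFin n))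
    ≡⟨ cong (signToℤ (sgn π) *_) (prodℤ-signToℤ (λ i → H i (f i) · H (π i) (f i)) (allFin n)) ⟩
  signToℤ (sgn π) * signToℤ (weight H f π)
    ≡⟨ signToℤ-· (sgn π) (weight H f π) ⟨
  signToℤ (sgn π · weight H f π) ∎
  where open ≡-Reasoning

positiveRep : ∀ {n} → Matrix± n → (f π : Fin n → Fin n) → Fin n → Bool
positiveRep H f π v = isRep π v ∧ isPositive (componentSign H f π v)

-- Each step sign is minus the corresponding factor of the weight. Regrouped by vertices, a
-- non-representative contributes (-1)(-1) and the representative of a cycle C contributes -(sign of C).
sgn·weight≡prodSign-positiveRep : ∀ {n} (H : Matrix± n) (f π : Fin n → Fin n) → Injective _≡_ _≡_ π →
  sgn π · weight H f π ≡ prodSign (map (neg1^ᵇ ∘ positiveRep H f π) (allFin n))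
sgn·weight≡prodSign-positiveRep {n} H f π π-injective = begin
  sgn π · weight H f π
    ≡⟨ cong₂ _·_ (sgn≡prodSign-nonRep π π-injective) weight≡minus·steps ⟩
  N · (M · S)
    ≡⟨ Sign.*-assoc N M S ⟨
  (N · M) · S
    ≡⟨ cong₂ _·_ (ProdSign.fold-map-∙ (neg1^ᵇ ∘ nonRep π) (λ _ → Sign.-) (allFin n))
                 (sym (Cycles.prodSign-cycles π π-injective (stepSign H f π))) ⟨
  prodSign (map (λ v → neg1^ᵇ (nonRep π v) · Sign.-) (allFin n)) · prodSign (map atRep (allFin n))
    ≡⟨ ProdSign.fold-map-∙ _ atRep (allFin n) ⟨
  prodSign (map (λ v → (neg1^ᵇ (nonRep π v) · Sign.-) · atRep v) (allFin n))
    ≡⟨ ProdSign.fold-map-ext (allFin n) (λ v → per-vertex (isRep π v) (componentSign H f π v)) ⟩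
  prodSign (map (neg1^ᵇ ∘ positiveRep H f π) (allFin n)) ∎
  where
    open ≡-Reasoning
    N M S : Sign
    N = prodSign (map (neg1^ᵇ ∘ nonRep π) (allFin n))
    M = prodSign (map (λ _ → Sign.-) (allFin n))
    S = prodSign (map (stepSign H f π) (allFin n))

    atRep : Fin n → Sign
    atRep v = if isRep π v then componentSign H f π v else Sign.+

    steps≡minus·weight : S ≡ M · weight H f π
    steps≡minus·weight = ProdSign.fold-map-∙ (λ _ → Sign.-) (λ i → H i (f i) · H (π i) (f i)) (allFin n)

    weight≡minus·steps : weight H f π ≡ M · S
    weight≡minus·steps = sym (begin
      M · S                    ≡⟨ cong (M ·_) steps≡minus·weight ⟩
      M · (M · weight H f π)   ≡⟨ Sign.*-assoc M M _ ⟨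
      (M · M) · weight H f π   ≡⟨ cong (_· weight H f π) (Sign.s*s≡+ M) ⟩
      weight H f π ∎)

    per-vertex : ∀ r c → (neg1^ᵇ (not r) · Sign.-) · (if r then c else Sign.+) ≡ neg1^ᵇ (r ∧ isPositive c)
    per-vertex true  Sign.- = refl
    per-vertex true  Sign.+ = refl
    per-vertex false c      = refl

expansionTerm≡neg1^pc : ∀ {n} (H : Matrix± n) (f π : Fin n → Fin n) → Injective _≡_ _≡_ π →
  expansionTerm H f π ≡ neg1^ (pc H f π)
expansionTerm≡neg1^pc {n} H f π π-injective = begin
  expansionTerm H f π
    ≡⟨ expansionTerm≡signToℤ H f π ⟩
  signToℤ (sgn π · weight H f π)
    ≡⟨ cong signToℤ (sgn·weight≡prodSign-positiveRep H f π π-injective) ⟩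
  signToℤ (prodSign (map (neg1^ᵇ ∘ positiveRep H f π) (allFin n)))
    ≡⟨ neg1^-count (positiveRep H f π) (allFin n) ⟨
  neg1^ (pc H f π) ∎
  where open ≡-Reasoning

-- Functions Fin m → Fin n are equal only pointwise, so sums over allFuns are reindexed through
-- the vectors that tabulate them, on which reindexing is a bijection up to _≡_.
allVecs : ∀ m n → List (Vec (Fin n) m)
allVecs zero    n = [] ∷ []
allVecs (suc m) n = concatMap (λ v → map (_∷ v) (allFin n)) (allVecs m n)

map-tabulate-allFuns : ∀ m n → map Vec.tabulate (allFuns m n) ≡ allVecs m n
map-tabulate-allFuns zero    n = refl
map-tabulate-allFuns (suc m) n = begin
  map Vec.tabulate (concatMap (λ g → map (_∷ᶠ g) (allFin n)) (allFuns m n))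
    ≡⟨ List.map-concatMap Vec.tabulate (λ g → map (_∷ᶠ g) (allFin n)) (allFuns m n) ⟩
  concatMap (λ g → map Vec.tabulate (map (_∷ᶠ g) (allFin n))) (allFuns m n)
    ≡⟨ cong concat (List.map-cong (λ g → sym (List.map-∘ (allFin n))) (allFuns m n)) ⟩
  concatMap (λ g → map (_∷ Vec.tabulate g) (allFin n)) (allFuns m n)
    ≡⟨ List.concatMap-map (λ v → map (_∷ v) (allFin n)) Vec.tabulate (allFuns m n) ⟨
  concatMap (λ v → map (_∷ v) (allFin n)) (map Vec.tabulate (allFuns m n))
    ≡⟨ cong (concatMap (λ v → map (_∷ v) (allFin n))) (map-tabulate-allFuns m n) ⟩
  allVecs (suc m) n ∎
  where open ≡-Reasoning

∈-allVecs : ∀ m n (v : Vec (Fin n) m) → v ∈ allVecs m n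
∈-allVecs zero    n []      = here refl
∈-allVecs (suc m) n (x ∷ v) = ∈-concatMap⁺ (λ v → map (_∷ v) (allFin n))
  (Any.map (λ { refl → ∈-map⁺ (_∷ v) (∈-allFin x) }) (∈-allVecs m n v))

allVecs-unique : ∀ m n → Unique (allVecs m n)
allVecs-unique zero    n = [] ∷ []
allVecs-unique (suc m) n =
  Uniqueₚ.concat⁺ (Allₚ.map⁺ (All.tabulate (λ _ → Uniqueₚ.map⁺ Vecₚ.∷-injectiveˡ (Uniqueₚ.allFin⁺ n))))
                 (AllPairsₚ.map⁺ (AllPairs.map disjoint (allVecs-unique m n)))
  where
    disjoint : ∀ {v v′ : Vec (Fin n) m} → v ≢ v′ → Disjoint (map (_∷ v) (allFin n)) (map (_∷ v′) (allFin n))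
    disjoint {v} {v′} v≢v′ (∈₁ , ∈₂) with ∈-map⁻ (_∷ v) ∈₁ | ∈-map⁻ (_∷ v′) ∈₂
    ... | _ , _ , refl | _ , _ , x∷v≡y∷v′ = v≢v′ (Vecₚ.∷-injectiveʳ x∷v≡y∷v′)

sum-allFuns≡sum-allVecs : ∀ {m n} (G : (Fin m → Fin n) → ℤ) → (∀ {F F′} → F ≗ F′ → G F ≡ G F′) →
  sumℤ (map G (allFuns m n)) ≡ sumℤ (map (G ∘ Vec.lookup) (allVecs m n))
sum-allFuns≡sum-allVecs {m} {n} G G-cong = begin
  sumℤ (map G (allFuns m n))
    ≡⟨ Sumℤ.fold-map-ext (allFuns m n) (λ F → G-cong (λ x → sym (Vecₚ.lookup∘tabulate F x))) ⟩
  sumℤ (map (G ∘ Vec.lookup ∘ Vec.tabulate) (allFuns m n))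
    ≡⟨ cong sumℤ (List.map-∘ (allFuns m n)) ⟩
  sumℤ (map (G ∘ Vec.lookup) (map Vec.tabulate (allFuns m n)))
    ≡⟨ cong (sumℤ ∘ map (G ∘ Vec.lookup)) (map-tabulate-allFuns m n) ⟩
  sumℤ (map (G ∘ Vec.lookup) (allVecs m n)) ∎
  where open ≡-Reasoning

sum-allFuns-∘-bijection : ∀ {m n} (G : (Fin m → Fin n) → ℤ) → (∀ {F F′} → F ≗ F′ → G F ≡ G F′) →
  ∀ (σ σ⁻¹ : Fin m → Fin m) → (∀ x → σ (σ⁻¹ x) ≡ x) → (∀ x → σ⁻¹ (σ x) ≡ x) →
  sumℤ (map (λ F → G (F ∘ σ)) (allFuns m n)) ≡ sumℤ (map G (allFuns m n))
sum-allFuns-∘-bijection {m} {n} G G-cong σ σ⁻¹ σσ⁻¹ σ⁻¹σ = begin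
  sumℤ (map (λ F → G (F ∘ σ)) (allFuns m n))
    ≡⟨ sum-allFuns≡sum-allVecs (λ F → G (F ∘ σ)) (λ F≗F′ → G-cong (F≗F′ ∘ σ)) ⟩
  sumℤ (map (λ v → G (Vec.lookup v ∘ σ)) (allVecs m n))
    ≡⟨ Sumℤ.fold-map-ext (allVecs m n) (λ v → G-cong (λ x → sym (Vecₚ.lookup∘tabulate (Vec.lookup v ∘ σ) x))) ⟩
  sumℤ (map (G ∘ Vec.lookup ∘ ψ σ) (allVecs m n))
    ≡⟨ Sumℤ.fold-map-bijection (G ∘ Vec.lookup) (ψ σ) (ψ σ⁻¹) (ψ-inverse σ σ⁻¹ σ⁻¹σ) (ψ-inverse σ⁻¹ σ σσ⁻¹)
         (allVecs-unique m n) (∈-allVecs m n) ⟩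
  sumℤ (map (G ∘ Vec.lookup) (allVecs m n))
    ≡⟨ sum-allFuns≡sum-allVecs G G-cong ⟨
  sumℤ (map G (allFuns m n)) ∎
  where
    open ≡-Reasoning
    ψ : (Fin m → Fin m) → Vec (Fin n) m → Vec (Fin n) m
    ψ ρ v = Vec.tabulate (Vec.lookup v ∘ ρ)
    ψ-inverse : ∀ ρ ρ′ → (∀ x → ρ′ (ρ x) ≡ x) → ∀ v → ψ ρ (ψ ρ′ v) ≡ v
    ψ-inverse ρ ρ′ ρ′ρ v = trans
      (Vecₚ.tabulate-cong (λ x → trans (Vecₚ.lookup∘tabulate (Vec.lookup v ∘ ρ′) (ρ x))
                                     (cong (Vec.lookup v) (ρ′ρ x))))
      (Vecₚ.tabulate∘lookup v)

-- Non-edge-monic classes cancel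

isInjective⇒Injective : ∀ {n} {π : Fin n → Fin n} → isInjective π ≡ true → Injective _≡_ _≡_ π
isInjective⇒Injective {n} {π} isInj {x} {y} πx≡πy = ==⇒≡
  (subst (λ t → (if t then x == y else true) ≡ true) (≡⇒== πx≡πy)
    (all≡true⇒∀ _ (allFin n) (all≡true⇒∀ _ (allFin n) isInj (∈-allFin x)) (∈-allFin y)))

Injective⇒isInjective : ∀ {n} {π : Fin n → Fin n} → Injective _≡_ _≡_ π → isInjective π ≡ true
Injective⇒isInjective {n} {π} π-injective =
  ∀⇒all≡true _ (allFin n) (λ {x} _ → ∀⇒all≡true _ (allFin n) (λ {y} _ → check x y))
  where
    check : ∀ x y → (if π x == π y then x == y else true) ≡ true
    check x y with π x == π y in πx==πy
    ... | true  = ≡⇒== (π-injective (==⇒≡ πx==πy))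
    ... | false = refl

isInjective≡false⇒collision : ∀ {n} {f : Fin n → Fin n} → isInjective f ≡ false → ∃[ i ] ∃[ j ] f i ≡ f j × i ≢ j
isInjective≡false⇒collision {n} {f} notInj with all≡false⇒∃ _ (allFin n) notInj
... | i , _ , row≡false with all≡false⇒∃ _ (allFin n) row≡false
...   | j , _ , check≡false with f i == f j in fi==fj
...     | true  = i , j , ==⇒≡ fi==fj , (λ i≡j → contradiction (trans (sym (≡⇒== i≡j)) check≡false) λ ())
...     | false = contradiction check≡false λ ()

isInjective-cong : ∀ {n} {π π′ : Fin n → Fin n} → π ≗ π′ → isInjective π ≡ isInjective π′
isInjective-cong π≗π′ = bool-ext (transfer π≗π′) (transfer (sym ∘ π≗π′))
  where
    transfer : ∀ {ρ ρ′} → ρ ≗ ρ′ → isInjective ρ ≡ true → isInjective ρ′ ≡ true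
    transfer ρ≗ρ′ isInj = Injective⇒isInjective (λ ρ′x≡ρ′y →
      isInjective⇒Injective isInj (trans (ρ≗ρ′ _) (trans ρ′x≡ρ′y (sym (ρ≗ρ′ _)))))

expansionTerm-cong : ∀ {n} (H : Matrix± n) (f : Fin n → Fin n) {π π′} → π ≗ π′ →
  expansionTerm H f π ≡ expansionTerm H f π′
expansionTerm-cong {n} H f {π} {π′} π≗π′ = begin
  expansionTerm H f π              ≡⟨ expansionTerm≡signToℤ H f π ⟩
  signToℤ (sgn π · weight H f π)   ≡⟨ cong signToℤ (cong₂ _·_ (sgn-cong π≗π′) weight-cong) ⟩
  signToℤ (sgn π′ · weight H f π′) ≡⟨ expansionTerm≡signToℤ H f π′ ⟨
  expansionTerm H f π′ ∎
  where
    open ≡-Reasoning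
    weight-cong : weight H f π ≡ weight H f π′
    weight-cong = ProdSign.fold-map-ext (allFin n) (λ i → cong (λ t → H i (f i) · H t (f i)) (π≗π′ i))

sum-neg : ∀ {B : Set} (g : B → ℤ) xs → sumℤ (map (-_ ∘ g) xs) ≡ - sumℤ (map g xs)
sum-neg g []       = refl
sum-neg g (x ∷ xs) = trans (cong (- g x +_) (sum-neg g xs)) (sym (ℤ.neg-distrib-+ (g x) _))

x≡-x⇒x≡0 : ∀ {x} → x ≡ - x → x ≡ 0ℤ
x≡-x⇒x≡0 {+0}         _  = refl
x≡-x⇒x≡0 {+[1+ n ]}   ()
x≡-x⇒x≡0 { -[1+ n ] } ()

module NonInjective {n} (H : Matrix± n) (f : Fin n → Fin n) (f-notInjective : isInjective f ≡ false) where

  private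
    collision : ∃[ i ] ∃[ j ] f i ≡ f j × i ≢ j
    collision = isInjective≡false⇒collision f-notInjective
    i j : Fin n
    i = proj₁ collision
    j = proj₁ (proj₂ collision)
    fi≡fj : f i ≡ f j
    fi≡fj = proj₁ (proj₂ (proj₂ collision))
    i≢j : i ≢ j
    i≢j = proj₂ (proj₂ (proj₂ collision))

    τ : Fin n → Fin n
    τ = transpose i j

    τ-involutive : ∀ k → τ (τ k) ≡ k
    τ-involutive = transpose-involutive i j

    f∘τ≗f : ∀ k → f (τ k) ≡ f k
    f∘τ≗f k with transposeView i j k
    ... | at-a refl τk≡j     = trans (cong f τk≡j) (sym fi≡fj)
    ... | at-b _ refl τk≡i   = trans (cong f τk≡i) fi≡fj
    ... | elsewhere _ _ τk≡k = cong f τk≡k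

    weight-∘τ : ∀ π → weight H f (π ∘ τ) ≡ weight H f π
    weight-∘τ π = begin
      prodSign (map (λ k → H k (f k) · H (π (τ k)) (f k)) (allFin n))
        ≡⟨ ProdSign.fold-map-ext (allFin n) (λ k → cong (λ t → H k (f k) · H (π (τ k)) t) (f∘τ≗f k)) ⟨
      prodSign (map (λ k → H k (f k) · H (π (τ k)) (f (τ k))) (allFin n))
        ≡⟨ ProdSign.fold-map-∙ _ _ (allFin n) ⟩
      prodSign (map (λ k → H k (f k)) (allFin n)) · prodSign (map (λ k → H (π (τ k)) (f (τ k))) (allFin n))
        ≡⟨ cong (prodSign (map (λ k → H k (f k)) (allFin n)) ·_)
                (prodSign-allFin-bijection τ τ τ-involutive τ-involutive (λ k → H (π k) (f k))) ⟩
      prodSign (map (λ k → H k (f k)) (allFin n)) · prodSign (map (λ k → H (π k) (f k)) (allFin n))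
        ≡⟨ ProdSign.fold-map-∙ _ _ (allFin n) ⟨
      weight H f π ∎
      where open ≡-Reasoning

    expansionTerm-∘τ : ∀ π → Injective _≡_ _≡_ π → expansionTerm H f (π ∘ τ) ≡ - expansionTerm H f π
    expansionTerm-∘τ π π-injective = begin
      expansionTerm H f (π ∘ τ)
        ≡⟨ expansionTerm≡signToℤ H f (π ∘ τ) ⟩
      signToℤ (sgn (π ∘ τ) · weight H f (π ∘ τ))
        ≡⟨ cong signToℤ (cong₂ _·_ (sgn-∘-transpose π π-injective i j i≢j) (weight-∘τ π)) ⟩
      signToℤ ((Sign.- · sgn π) · weight H f π)
        ≡⟨ cong signToℤ (Sign.*-assoc Sign.- (sgn π) (weight H f π)) ⟩
      signToℤ (Sign.- · (sgn π · weight H f π))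
        ≡⟨ signToℤ-opposite (sgn π · weight H f π) ⟩
      - signToℤ (sgn π · weight H f π)
        ≡⟨ cong -_ (expansionTerm≡signToℤ H f π) ⟨
      - expansionTerm H f π ∎
      where open ≡-Reasoning

    G : (Fin n → Fin n) → ℤ
    G π = if isInjective π then expansionTerm H f π else 0ℤ

    G-cong : ∀ {π π′} → π ≗ π′ → G π ≡ G π′
    G-cong π≗π′ = cong₂ (λ b t → if b then t else 0ℤ) (isInjective-cong π≗π′) (expansionTerm-cong H f π≗π′)

    isInjective-∘τ : ∀ π → isInjective (π ∘ τ) ≡ isInjective π
    isInjective-∘τ π = bool-ext
      (λ isInj → trans (sym (isInjective-cong (cong π ∘ τ-involutive))) (∘τ-preserves isInj))
      ∘τ-preserves
      where
        ∘τ-preserves : ∀ {ρ} → isInjective ρ ≡ true → isInjective (ρ ∘ τ) ≡ true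
        ∘τ-preserves isInj = Injective⇒isInjective (Injective-∘-transpose i j (isInjective⇒Injective isInj))

    G-∘τ : ∀ π → G (π ∘ τ) ≡ - G π
    G-∘τ π rewrite isInjective-∘τ π with isInjective π in isInj
    ... | true  = expansionTerm-∘τ π (isInjective⇒Injective isInj)
    ... | false = refl

    sum-allPerms≡sum-G : sumℤ (map (expansionTerm H f) (allPerms n)) ≡ sumℤ (map G (allFuns n n))
    sum-allPerms≡sum-G = trans
      (Sumℤ.fold-filter (λ π → isInjective π Bool.≟ true) (expansionTerm H f) (allFuns n n))
      (Sumℤ.fold-map-ext (allFuns n n) (λ π →
        cong (λ b → if b then expansionTerm H f π else 0ℤ) (does-≟-true (isInjective π))))

  sum-expansionTerm≡0 : sumℤ (map (expansionTerm H f) (allPerms n)) ≡ 0ℤ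
  sum-expansionTerm≡0 = trans sum-allPerms≡sum-G (x≡-x⇒x≡0 (begin
    sumℤ (map G (allFuns n n))                  ≡⟨ sum-allFuns-∘-bijection G G-cong τ τ τ-involutive τ-involutive ⟨
    sumℤ (map (λ π → G (π ∘ τ)) (allFuns n n))  ≡⟨ Sumℤ.fold-map-ext (allFuns n n) G-∘τ ⟩
    sumℤ (map (λ π → - G π) (allFuns n n))      ≡⟨ sum-neg G (allFuns n n) ⟩
    - sumℤ (map G (allFuns n n)) ∎))
    where open ≡-Reasoning

classSum≡sum-expansionTerm : ∀ {n} (H : Matrix± n) (f : Fin n → Fin n) →
  classSum H f ≡ sumℤ (map (expansionTerm H f) (allPerms n))
classSum≡sum-expansionTerm {n} H f = Sumℤ.fold-map-cong (allPerms n) (λ π π∈allPerms →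
  sym (expansionTerm≡neg1^pc H f π (isInjective⇒Injective
    (proj₂ (∈-filter⁻ (λ π → isInjective π Bool.≟ true) {xs = allFuns n n} π∈allPerms)))))

theorem2 : (n : ℕ) (H : Matrix± n) →
    (sumℤ (map (classSum H) (nonEdgeMonicClasses n)) ≡ 0ℤ)
    × (det (laplacian H) ≡ sumℤ (map (classSum H) (edgeMonicClasses n)))
theorem2 n H = nonEdgeMonic≡0 , (begin
  det (laplacian H)
    ≡⟨ det-laplacian-expansion H ⟩
  sumℤ (map (λ f → sumℤ (map (expansionTerm H f) (allPerms n))) (allFuns n n))
    ≡⟨ Sumℤ.fold-map-ext (allFuns n n) (λ f → sym (classSum≡sum-expansionTerm H f)) ⟩
  sumℤ (map (classSum H) (allFuns n n))
    ≡⟨ Sumℤ.fold-partition isInjective (classSum H) (allFuns n n) ⟨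
  edgeMonic + sumℤ (map (classSum H) (nonEdgeMonicClasses n))
    ≡⟨ cong (edgeMonic +_) nonEdgeMonic≡0 ⟩
  edgeMonic + 0ℤ
    ≡⟨ ℤ.+-identityʳ edgeMonic ⟩
  edgeMonic ∎)
  where
    open ≡-Reasoning
    edgeMonic : ℤ
    edgeMonic = sumℤ (map (classSum H) (edgeMonicClasses n))
    nonEdgeMonic≡0 : sumℤ (map (classSum H) (nonEdgeMonicClasses n)) ≡ 0ℤ
    nonEdgeMonic≡0 = trans
      (Sumℤ.fold-map-cong (nonEdgeMonicClasses n) (λ f f∈ → trans (classSum≡sum-expansionTerm H f)
        (NonInjective.sum-expansionTerm≡0 H f
          (proj₂ (∈-filter⁻ (λ f → isInjective f Bool.≟ false) {xs = allFuns n n} f∈)))))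
      (Sumℤ.fold-map-ε (nonEdgeMonicClasses n))
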